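{- Let $m\ge1$ and $m_0$ be integers, and let $F(q)=(\gamma(t,q)-1)^m/q^{m_0}$ (a formal Laurent series in $q$). Then $$0=-q^{m-m_0}+\beta(m;t,q)\,F-t^m q^{m+m_0}F^2.$$
   Context: Let $t,q$ be indeterminates. The Narayana polynomials are $\gamma_0(t)=1$ and $\gamma_n(t)=\sum_{k=0}^{n-1}\binom{n}{k}\binom{n-1}{k}\frac{1}{k+1}t^k$ for $n\ge1$, and $\gamma(t,q)=\sum_{n\ge0}\gamma_n(t)q^n$; it satisfies $-1+(1-q+tq)\gamma-tq\gamma^2=0$. For $0\le d\le m-1$ let $\rho(m;t,d)=\frac{m}{m-d}\sum_{i=0}^{d}\binom{m-1-d+i}{i}\binom{m-1-i}{d-i}t^i$, let $\rho(m;t,m)=1+t^m$, and $\beta(m;t,q)=\sum_{d=0}^{m}\rho(m;t,d)(-q)^d$. -}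

module Defs where

open import Data.Nat as ℕ using (ℕ; zero; suc; _≤?_; _<?_; _≟_)
open import Data.Nat.Combinatorics using (_C_)
open import Data.Integer as ℤ using (ℤ; +_; -[1+_])
open import Data.Rational as ℚ using (ℚ; 0ℚ; 1ℚ)
open import Relation.Nullary using (yes; no)
open import Relation.Binary.PropositionalEquality using (_≡_)

-- Formal power series in q with coefficients in ℚ[t], represented as
-- bivariate coefficient arrays:  f n k = coefficient of q^n t^k.
-- (ℚ[t][[q]] embeds in ℚ[[t,q]], so coefficientwise equality is faithful.)

PS : Set
PS = ℕ → ℕ → ℚ

Σ≤ : ℕ → (ℕ → ℚ) → ℚ
Σ≤ zero    f = f zero
Σ≤ (suc n) f = Σ≤ n f ℚ.+ f (suc n)

psOne : PS
psOne zero zero = 1ℚ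
psOne _    _    = 0ℚ

psAdd : PS → PS → PS
psAdd f g n k = f n k ℚ.+ g n k

psNeg : PS → PS
psNeg f n k = ℚ.- f n k

psSub : PS → PS → PS
psSub f g = psAdd f (psNeg g)

psMul : PS → PS → PS
psMul f g n k = Σ≤ n (λ a → Σ≤ k (λ b → f a b ℚ.* g (n ℕ.∸ a) (k ℕ.∸ b)))

psPow : PS → ℕ → PS
psPow f zero    = psOne
psPow f (suc n) = psMul f (psPow f n)

tPow : ℕ → PS
tPow m zero k with k ≟ m
... | yes _ = 1ℚ
... | no  _ = 0ℚ
tPow m (suc _) _ = 0ℚ

-- Formal Laurent series in q over ℚ[t]:  q^shift · ser.

record Laurent : Set where
  constructor laurent
  field
    shift : ℤ
    ser   : PS
open Laurent public

lcoef : Laurent → ℤ → ℕ → ℚ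
lcoef L e k with e ℤ.- shift L
... | + j      = ser L j k
... | -[1+ _ ] = 0ℚ

lAdd : Laurent → Laurent → Laurent
lAdd L M = laurent s (λ n k → lcoef L (s ℤ.+ + n) k ℚ.+ lcoef M (s ℤ.+ + n) k)
  where s = shift L ℤ.⊓ shift M

lNeg : Laurent → Laurent
lNeg L = laurent (shift L) (psNeg (ser L))

lSub : Laurent → Laurent → Laurent
lSub L M = lAdd L (lNeg M)

lMul : Laurent → Laurent → Laurent
lMul L M = laurent (shift L ℤ.+ shift M) (psMul (ser L) (ser M))

_≈L_ : Laurent → Laurent → Set
L ≈L M = ∀ (e : ℤ) (k : ℕ) → lcoef L e k ≡ lcoef M e k

lZero : Laurent
lZero = laurent (+ 0) (λ _ _ → 0ℚ)

qPow : ℤ → Laurent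
qPow e = laurent e psOne

narayanaCoef : ℕ → ℕ → ℚ
narayanaCoef zero zero = 1ℚ
narayanaCoef zero (suc _) = 0ℚ
narayanaCoef (suc n) k with k ℕ.≤? n
... | yes _ = (+ ((suc n C k) ℕ.* (n C k))) ℚ./ suc k
... | no  _ = 0ℚ

gamma : PS
gamma = narayanaCoef

-- a / n as a rational; only used with n ≥ 1 (value at n = 0 irrelevant)
frac : ℤ → ℕ → ℚ
frac a zero    = 0ℚ
frac a (suc n) = a ℚ./ suc n

-- coefficient of t^i in ρ(m;t,d), for 0 ≤ d ≤ m (and 0 for d > m)
rhoCoef : ℕ → ℕ → ℕ → ℚ
rhoCoef m d i with d ℕ.<? m
... | yes _ with i ℕ.≤? d
...   | yes _ = frac (+ m) (m ℕ.∸ d) ℚ.*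
                  ((+ (((m ℕ.∸ 1 ℕ.∸ d ℕ.+ i) C i) ℕ.* ((m ℕ.∸ 1 ℕ.∸ i) C (d ℕ.∸ i)))) ℚ./ 1)
...   | no  _ = 0ℚ
rhoCoef m d i | no _ with d ≟ m
... | no  _ = 0ℚ
... | yes _ = δ0 i ℚ.+ δm i
  where
    δ0 : ℕ → ℚ
    δ0 zero = 1ℚ
    δ0 (suc _) = 0ℚ
    δm : ℕ → ℚ
    δm j with j ≟ m
    ... | yes _ = 1ℚ
    ... | no  _ = 0ℚ

sgn : ℕ → ℚ
sgn zero    = 1ℚ
sgn (suc d) = ℚ.- sgn d

-- β(m;t,q) = Σ_{d=0}^{m} ρ(m;t,d) (-q)^d
beta : ℕ → PS
beta m d i = sgn d ℚ.* rhoCoef m d i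

Fser : ℕ → ℤ → Laurent
Fser m m0 = lMul (laurent (+ 0) (psPow (psSub gamma psOne) m)) (qPow (ℤ.- m0))

{-# OPTIONS --safe #-}
-- Write G = γ − 1 and s = 1 − q − tq. The Narayana relation for γ reads q − sG + tqG² = 0, so
-- A = tqG and B = s − A satisfy A + B = s, AB = tq², BG = q and AG = tqG². The coefficients ρ obey
-- ρ(m+2; t, d) = ρ(m+1; t, d) + (1 + t) ρ(m+1; t, d−1) − t ρ(m; t, d−2), which is Pascal's rule in
-- disguise; hence β_{m+2} = s β_{m+1} − tq² β_m with β_0 = 2 and β_1 = s, so β_m = A^m + B^m and
-- β_m G^m = (BG)^m + (AG)^m = q^m + t^m q^m G^{2m}. Dividing by q^{m₀} gives the claim.
--
-- The Narayana relation itself comes from the three-term recurrence of the Narayana numbers, which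
-- says that G solves Δ θG + sG = 2q for θ = q d/dq and Δ = s² − 4tq². Then V = s − 2tqG satisfies
-- 2Δ θV = (θΔ) V, so D = V² − Δ = 4tq(q − sG + tqG²) satisfies Δ θD = (θΔ) D; having no constant
-- term, D vanishes.
module Submission where

open import Level using (0ℓ)
open import Algebra.Bundles using (CommutativeRing; RawRing)
open import Algebra.Structures using (IsCommutativeRing)
import Algebra.Solver.Ring.AlmostCommutativeRing as ACR
open import Data.Empty using (⊥-elim)
open import Data.Maybe using (Maybe; just; nothing)
open import Data.Product using (_,_)
open import Data.Sum using (inj₁; inj₂)
open import Data.Nat as ℕ using (ℕ; zero; suc; _∸_; _≤_; _<_; z≤n; s≤s; _!)
import Data.Nat.Properties as ℕ
open import Data.Nat.Combinatorics using (_C_; nCn≡1; k>n⇒nCk≡0; nCk+nC[k+1]≡[n+1]C[k+1])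
open import Data.Integer as ℤ using (ℤ; +_; -[1+_])
import Data.Integer.Properties as ℤ
open import Data.Rational as ℚ using (ℚ; 0ℚ; 1ℚ)
import Data.Rational.Properties as ℚ
open import Data.Rational.Unnormalised as ℚᵘ using (mkℚᵘ; *≡*)
import Data.Rational.Unnormalised.Properties as ℚᵘ
open import Relation.Nullary using (yes; no)
open import Relation.Binary.Definitions using (tri<; tri≈; tri>)
open import Relation.Binary.PropositionalEquality as ≡ using (_≡_; _≢_)
open import Tactic.RingSolver.Core.AlmostCommutativeRing using (AlmostCommutativeRing; fromCommutativeRing)
import Tactic.RingSolver

module PowerSeries {c ℓ} (R : CommutativeRing c ℓ) where

  open CommutativeRing R hiding (zero; isCommutativeRing)
  open import Relation.Binary.Reasoning.Setoid setoid
  open import Algebra.Properties.Ring ring using (-0#≈0#)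
  open import Algebra.Properties.CommutativeSemigroup +-commutativeSemigroup using (interchange)

  ∑ : ℕ → (ℕ → Carrier) → Carrier
  ∑ zero    f = f zero
  ∑ (suc n) f = ∑ n f + f (suc n)

  ∑-cong : ∀ n {f g : ℕ → Carrier} → (∀ a → a ≤ n → f a ≈ g a) → ∑ n f ≈ ∑ n g
  ∑-cong zero    f≈g = f≈g zero z≤n
  ∑-cong (suc n) f≈g = +-cong (∑-cong n (λ a a≤n → f≈g a (ℕ.m≤n⇒m≤1+n a≤n))) (f≈g (suc n) ℕ.≤-refl)

  ∑-congᵘ : ∀ n {f g : ℕ → Carrier} → (∀ a → f a ≈ g a) → ∑ n f ≈ ∑ n g
  ∑-congᵘ n f≈g = ∑-cong n (λ a _ → f≈g a)

  ∑-zero : ∀ n {f : ℕ → Carrier} → (∀ a → a ≤ n → f a ≈ 0#) → ∑ n f ≈ 0#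
  ∑-zero n f≈0 = trans (∑-cong n f≈0) (go n)
    where
    go : ∀ n → ∑ n (λ _ → 0#) ≈ 0#
    go zero    = refl
    go (suc n) = trans (+-congʳ (go n)) (+-identityˡ 0#)

  ∑-distrib-+ : ∀ n (f g : ℕ → Carrier) → ∑ n (λ a → f a + g a) ≈ ∑ n f + ∑ n g
  ∑-distrib-+ zero    f g = refl
  ∑-distrib-+ (suc n) f g = begin
    ∑ n (λ a → f a + g a) + (f (suc n) + g (suc n)) ≈⟨ +-congʳ (∑-distrib-+ n f g) ⟩
    (∑ n f + ∑ n g) + (f (suc n) + g (suc n))       ≈⟨ interchange (∑ n f) (∑ n g) (f (suc n)) (g (suc n)) ⟩
    (∑ n f + f (suc n)) + (∑ n g + g (suc n))       ∎

  *-distribˡ-∑ : ∀ n x (f : ℕ → Carrier) → x * ∑ n f ≈ ∑ n (λ a → x * f a)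
  *-distribˡ-∑ zero    x f = refl
  *-distribˡ-∑ (suc n) x f = trans (distribˡ x _ _) (+-congʳ (*-distribˡ-∑ n x f))

  *-distribʳ-∑ : ∀ n x (f : ℕ → Carrier) → ∑ n f * x ≈ ∑ n (λ a → f a * x)
  *-distribʳ-∑ zero    x f = refl
  *-distribʳ-∑ (suc n) x f = trans (distribʳ x _ _) (+-congʳ (*-distribʳ-∑ n x f))

  ∑-head : ∀ n (f : ℕ → Carrier) → ∑ (suc n) f ≈ f zero + ∑ n (λ a → f (suc a))
  ∑-head zero    f = refl
  ∑-head (suc n) f = trans (+-congʳ (∑-head n f)) (+-assoc _ _ _)

  ∑-head-only : ∀ n (f : ℕ → Carrier) → (∀ a → f (suc a) ≈ 0#) → ∑ n f ≈ f zero
  ∑-head-only zero    f _    = refl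
  ∑-head-only (suc n) f tail≈0 = begin
    ∑ (suc n) f                   ≈⟨ ∑-head n f ⟩
    f zero + ∑ n (λ a → f (suc a)) ≈⟨ +-congˡ (∑-zero n (λ a _ → tail≈0 a)) ⟩
    f zero + 0#                   ≈⟨ +-identityʳ _ ⟩
    f zero                        ∎

  ∑-reverse : ∀ n (f : ℕ → Carrier) → ∑ n f ≈ ∑ n (λ a → f (n ∸ a))
  ∑-reverse zero    f = refl
  ∑-reverse (suc n) f = begin
    ∑ n f + f (suc n)                      ≈⟨ +-congʳ (∑-reverse n f) ⟩
    ∑ n (λ a → f (n ∸ a)) + f (suc n)      ≈⟨ +-comm _ _ ⟩
    f (suc n) + ∑ n (λ a → f (n ∸ a))      ≈⟨ ∑-head n (λ a → f (suc n ∸ a)) ⟨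
    ∑ (suc n) (λ a → f (suc n ∸ a))        ∎

  ∑-≡ : ∀ {m n} (f : ℕ → Carrier) → m ≡ n → ∑ m f ≈ ∑ n f
  ∑-≡ f ≡.refl = refl

  ∑-triangle : ∀ n (F : ℕ → ℕ → Carrier) →
               ∑ n (λ a → ∑ a (F a)) ≈ ∑ n (λ b → ∑ (n ∸ b) (λ c → F (b ℕ.+ c) b))
  ∑-triangle zero    F = refl
  ∑-triangle (suc n) F = begin
    ∑ n (λ a → ∑ a (F a)) + ∑ (suc n) (F (suc n))
      ≈⟨ +-congʳ (∑-triangle n F) ⟩
    ∑ n (λ b → ∑ (n ∸ b) (col b)) + (∑ n (F (suc n)) + F (suc n) (suc n))
      ≈⟨ sym (+-assoc _ _ _) ⟩
    (∑ n (λ b → ∑ (n ∸ b) (col b)) + ∑ n (F (suc n))) + F (suc n) (suc n)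
      ≈⟨ +-congʳ (sym (∑-distrib-+ n _ _)) ⟩
    ∑ n (λ b → ∑ (n ∸ b) (col b) + F (suc n) b) + F (suc n) (suc n)
      ≈⟨ +-cong (∑-cong n extend-column) last-column ⟩
    ∑ n (λ b → ∑ (suc n ∸ b) (col b)) + ∑ (suc n ∸ suc n) (col (suc n)) ∎
    where
    col : ℕ → ℕ → Carrier
    col b c = F (b ℕ.+ c) b
    extend-column : ∀ b → b ≤ n → ∑ (n ∸ b) (col b) + F (suc n) b ≈ ∑ (suc n ∸ b) (col b)
    extend-column b b≤n = begin
      ∑ (n ∸ b) (col b) + F (suc n) b     ≈⟨ +-congˡ (reflexive (≡.cong (λ x → F x b) (≡.sym b+[1+n-b]≡1+n))) ⟩
      ∑ (suc (n ∸ b)) (col b)             ≈⟨ ∑-≡ (col b) (≡.sym (ℕ.+-∸-assoc 1 b≤n)) ⟩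
      ∑ (suc n ∸ b) (col b)               ∎
      where
      b+[1+n-b]≡1+n : b ℕ.+ suc (n ∸ b) ≡ suc n
      b+[1+n-b]≡1+n = ≡.trans (ℕ.+-suc b (n ∸ b)) (≡.cong suc (ℕ.m+[n∸m]≡n b≤n))
    last-column : F (suc n) (suc n) ≈ ∑ (suc n ∸ suc n) (col (suc n))
    last-column = trans (reflexive (≡.cong (λ x → F x (suc n)) (≡.sym (ℕ.+-identityʳ (suc n)))))
                        (∑-≡ (col (suc n)) (≡.sym (ℕ.n∸n≡0 n)))

  Series : Set c
  Series = ℕ → Carrier

  infix 4 _≋_
  _≋_ : Series → Series → Set ℓ
  f ≋ g = ∀ n → f n ≈ g n

  infixl 6 _+ₛ_
  infixl 7 _*ₛ_
  _+ₛ_ _*ₛ_ : Series → Series → Series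
  (f +ₛ g) n = f n + g n
  (f *ₛ g) n = ∑ n (λ a → f a * g (n ∸ a))

  -ₛ_ : Series → Series
  (-ₛ f) n = - f n

  const : Carrier → Series
  const x zero    = x
  const x (suc _) = 0#

  0ₛ 1ₛ : Series
  0ₛ _ = 0#
  1ₛ   = const 1#

  *ₛ-cong : ∀ {f f′ g g′} → f ≋ f′ → g ≋ g′ → f *ₛ g ≋ f′ *ₛ g′
  *ₛ-cong f≋f′ g≋g′ n = ∑-congᵘ n (λ a → *-cong (f≋f′ a) (g≋g′ (n ∸ a)))

  *ₛ-comm : ∀ f g → f *ₛ g ≋ g *ₛ f
  *ₛ-comm f g n = begin
    ∑ n (λ a → f a * g (n ∸ a))             ≈⟨ ∑-reverse n _ ⟩
    ∑ n (λ a → f (n ∸ a) * g (n ∸ (n ∸ a))) ≈⟨ ∑-cong n swap ⟩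
    ∑ n (λ a → g a * f (n ∸ a))             ∎
    where
    swap : ∀ a → a ≤ n → f (n ∸ a) * g (n ∸ (n ∸ a)) ≈ g a * f (n ∸ a)
    swap a a≤n = trans (*-comm _ _) (*-congʳ (reflexive (≡.cong g (ℕ.m∸[m∸n]≡n a≤n))))

  const-*ₛ : ∀ x f → const x *ₛ f ≋ (λ n → x * f n)
  const-*ₛ x f n = ∑-head-only n _ (λ _ → zeroˡ _)

  *ₛ-identityˡ : ∀ f → 1ₛ *ₛ f ≋ f
  *ₛ-identityˡ f n = trans (const-*ₛ 1# f n) (*-identityˡ (f n))

  *ₛ-distribˡ : ∀ f g h → f *ₛ (g +ₛ h) ≋ f *ₛ g +ₛ f *ₛ h
  *ₛ-distribˡ f g h n = trans (∑-congᵘ n (λ a → distribˡ _ _ _)) (∑-distrib-+ n _ _)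

  *ₛ-assoc : ∀ f g h → (f *ₛ g) *ₛ h ≋ f *ₛ (g *ₛ h)
  *ₛ-assoc f g h n = begin
    ∑ n (λ a → ∑ a (λ b → f b * g (a ∸ b)) * h (n ∸ a))
      ≈⟨ ∑-congᵘ n (λ a → *-distribʳ-∑ a _ _) ⟩
    ∑ n (λ a → ∑ a (λ b → f b * g (a ∸ b) * h (n ∸ a)))
      ≈⟨ ∑-triangle n _ ⟩
    ∑ n (λ b → ∑ (n ∸ b) (λ c → f b * g ((b ℕ.+ c) ∸ b) * h (n ∸ (b ℕ.+ c))))
      ≈⟨ ∑-congᵘ n (λ b → ∑-congᵘ (n ∸ b) (λ c → trans (*-assoc _ _ _) (*-congˡ (*-cong
           (reflexive (≡.cong g (ℕ.m+n∸m≡n b c))) (reflexive (≡.cong h (≡.sym (ℕ.∸-+-assoc n b c)))))))) ⟩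
    ∑ n (λ b → ∑ (n ∸ b) (λ c → f b * (g c * h ((n ∸ b) ∸ c))))
      ≈⟨ ∑-congᵘ n (λ b → sym (*-distribˡ-∑ (n ∸ b) _ _)) ⟩
    ∑ n (λ b → f b * ∑ (n ∸ b) (λ c → g c * h ((n ∸ b) ∸ c))) ∎

  isCommutativeRing : IsCommutativeRing _≋_ _+ₛ_ _*ₛ_ -ₛ_ 0ₛ 1ₛ
  isCommutativeRing = record
    { isRing = record
      { +-isAbelianGroup = record
        { isGroup = record
          { isMonoid = record
            { isSemigroup = record
              { isMagma = record
                { isEquivalence = record
                  { refl  = λ _ → refl
                  ; sym   = λ f≋g n → sym (f≋g n)
                  ; trans = λ f≋g g≋h n → trans (f≋g n) (g≋h n)
                  }
                ; ∙-cong = λ f≋f′ g≋g′ n → +-cong (f≋f′ n) (g≋g′ n)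
                }
              ; assoc = λ _ _ _ _ → +-assoc _ _ _
              }
            ; identity = (λ _ _ → +-identityˡ _) , (λ _ _ → +-identityʳ _)
            }
          ; inverse = (λ _ _ → -‿inverseˡ _) , (λ _ _ → -‿inverseʳ _)
          ; ⁻¹-cong = λ f≋g n → -‿cong (f≋g n)
          }
        ; comm = λ _ _ _ → +-comm _ _
        }
      ; *-cong     = *ₛ-cong
      ; *-assoc    = *ₛ-assoc
      ; *-identity = *ₛ-identityˡ , λ f n → trans (*ₛ-comm f 1ₛ n) (*ₛ-identityˡ f n)
      ; distrib    = *ₛ-distribˡ , λ f g h n → trans (*ₛ-comm (g +ₛ h) f n)
                       (trans (*ₛ-distribˡ f g h n) (+-cong (*ₛ-comm f g n) (*ₛ-comm f h n)))
      }
    ; *-comm = *ₛ-comm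
    }

  commutativeRing : CommutativeRing c ℓ
  commutativeRing = record { isCommutativeRing = isCommutativeRing }

  const-cong : ∀ {x y} → x ≈ y → const x ≋ const y
  const-cong x≈y zero    = x≈y
  const-cong x≈y (suc n) = refl

  const-+ : ∀ x y → const (x + y) ≋ const x +ₛ const y
  const-+ x y zero    = refl
  const-+ x y (suc n) = sym (+-identityˡ 0#)

  const-* : ∀ x y → const (x * y) ≋ const x *ₛ const y
  const-* x y n = sym (trans (const-*ₛ x (const y) n) (lemma n))
    where
    lemma : ∀ n → x * const y n ≈ const (x * y) n
    lemma zero    = refl
    lemma (suc n) = zeroʳ x

  const-neg : ∀ x → const (- x) ≋ -ₛ const x
  const-neg x zero    = refl
  const-neg x (suc n) = sym -0#≈0#

  const-0 : const 0# ≋ 0ₛ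
  const-0 zero    = refl
  const-0 (suc n) = refl

  X : Series
  X zero          = 0#
  X (suc zero)    = 1#
  X (suc (suc _)) = 0#

  shift : Series → Series
  shift f zero    = 0#
  shift f (suc n) = f n

  X-*ₛ : ∀ f → X *ₛ f ≋ shift f
  X-*ₛ f zero    = zeroˡ _
  X-*ₛ f (suc n) = begin
    ∑ (suc n) (λ a → X a * f (suc n ∸ a))        ≈⟨ ∑-head n _ ⟩
    0# * f (suc n) + ∑ n (λ a → X (suc a) * f (n ∸ a)) ≈⟨ +-cong (zeroˡ _) (trans (∑-head-only n _ (λ _ → zeroˡ _)) (*-identityˡ _)) ⟩
    0# + f n                                   ≈⟨ +-identityˡ _ ⟩
    f n                                        ∎

  module Derivation (w : ℕ → Carrier) (w-additive : ∀ n a → a ≤ n → w a + w (n ∸ a) ≈ w n) where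

    θ : Series → Series
    θ f n = w n * f n

    θ-+ : ∀ f g → θ (f +ₛ g) ≋ θ f +ₛ θ g
    θ-+ f g n = distribˡ _ _ _

    θ-neg : ∀ f → θ (-ₛ f) ≋ -ₛ θ f
    θ-neg f n = sym (-‿distribʳ-* (w n) (f n))
      where open import Algebra.Properties.Ring ring using (-‿distribʳ-*)

    w0≈0 : w 0 ≈ 0#
    w0≈0 = begin
      w 0                 ≈⟨ sym (+-identityʳ _) ⟩
      w 0 + 0#            ≈⟨ +-congˡ (sym (-‿inverseʳ (w 0))) ⟩
      w 0 + (w 0 - w 0)   ≈⟨ sym (+-assoc _ _ _) ⟩
      (w 0 + w 0) - w 0   ≈⟨ +-congʳ (w-additive 0 0 z≤n) ⟩
      w 0 - w 0           ≈⟨ -‿inverseʳ _ ⟩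
      0#                  ∎

    θ-const : ∀ x → θ (const x) ≋ 0ₛ
    θ-const x zero    = trans (*-congʳ w0≈0) (zeroˡ _)
    θ-const x (suc n) = zeroʳ _

    θ-X : w 1 ≈ 1# → θ X ≋ X
    θ-X w1≈1 zero             = zeroʳ _
    θ-X w1≈1 (suc zero)       = trans (*-congʳ w1≈1) (*-identityˡ _)
    θ-X w1≈1 (suc (suc n))    = zeroʳ _

    θ-* : ∀ f g → θ (f *ₛ g) ≋ θ f *ₛ g +ₛ f *ₛ θ g
    θ-* f g n = begin
      w n * ∑ n (λ a → f a * g (n ∸ a))                           ≈⟨ *-distribˡ-∑ n (w n) _ ⟩
      ∑ n (λ a → w n * (f a * g (n ∸ a)))                         ≈⟨ ∑-cong n (λ a a≤n → *-congʳ (sym (w-additive n a a≤n))) ⟩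
      ∑ n (λ a → (w a + w (n ∸ a)) * (f a * g (n ∸ a)))           ≈⟨ ∑-congᵘ n (λ a → leibniz (w a) (w (n ∸ a)) (f a) (g (n ∸ a))) ⟩
      ∑ n (λ a → (w a * f a) * g (n ∸ a) + f a * (w (n ∸ a) * g (n ∸ a))) ≈⟨ ∑-distrib-+ n _ _ ⟩
      (θ f *ₛ g) n + (f *ₛ θ g) n                                 ∎
      where
      leibniz : ∀ x y u v → (x + y) * (u * v) ≈ (x * u) * v + u * (y * v)
      leibniz x y u v = begin
        (x + y) * (u * v)         ≈⟨ distribʳ _ _ _ ⟩
        x * (u * v) + y * (u * v) ≈⟨ +-cong (sym (*-assoc _ _ _)) (trans (sym (*-assoc _ _ _)) (trans (*-congʳ (*-comm y u)) (*-assoc _ _ _))) ⟩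
        (x * u) * v + u * (y * v) ∎

    -- P θD = (θP) D says that D/P is constant. Once D vanishes below degree n + 1, the coefficient of
    -- degree n + 1 of this equation reads w(n + 1)·D(n + 1) = 0.
    vanishing-wronskian : ∀ (P D : Series) → P *ₛ θ D ≋ θ P *ₛ D → P 0 ≈ 1# → D 0 ≈ 0# →
                          (∀ n x → w (suc n) * x ≈ 0# → x ≈ 0#) → D ≋ 0ₛ
    vanishing-wronskian P D wronskian P0≈1 D0≈0 cancel n = below n n ℕ.≤-refl
      where
      below : ∀ n a → a ≤ n → D a ≈ 0#
      below zero    zero z≤n = D0≈0
      below (suc n) a a≤1+n with ℕ.m≤n⇒m<n∨m≡n a≤1+n
      ... | inj₁ (s≤s a≤n) = below n a a≤n
      ... | inj₂ ≡.refl    = cancel n (D (suc n)) (begin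
        w (suc n) * D (suc n)
          ≈⟨ sym (trans (+-congʳ (*-congʳ P0≈1)) (trans (+-congʳ (*-identityˡ _)) (+-identityʳ _))) ⟩
        P 0 * θ D (suc n) + 0#
          ≈⟨ +-congˡ (sym (∑-zero n (λ b _ → trans (*-congˡ (θD-earlier b)) (zeroʳ _)))) ⟩
        P 0 * θ D (suc n) + ∑ n (λ b → P (suc b) * θ D (n ∸ b))
          ≈⟨ ∑-head n _ ⟨
        (P *ₛ θ D) (suc n)
          ≈⟨ wronskian (suc n) ⟩
        (θ P *ₛ D) (suc n)
          ≈⟨ ∑-head n _ ⟩
        θ P 0 * D (suc n) + ∑ n (λ b → θ P (suc b) * D (n ∸ b))
          ≈⟨ +-cong (trans (*-congʳ (θ-const (P 0) 0)) (zeroˡ _)) (∑-zero n (λ b _ → trans (*-congˡ (earlier b)) (zeroʳ _))) ⟩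
        0# + 0#
          ≈⟨ +-identityʳ _ ⟩
        0# ∎)
        where
        earlier : ∀ b → D (n ∸ b) ≈ 0#
        earlier b = below n (n ∸ b) (ℕ.m∸n≤m n b)
        θD-earlier : ∀ b → θ D (n ∸ b) ≈ 0#
        θD-earlier b = trans (*-congˡ (earlier b)) (zeroʳ _)


module LucasSequence {c ℓ} (R : CommutativeRing c ℓ) where

  open CommutativeRing R hiding (zero)
  open import Relation.Binary.Reasoning.Setoid setoid
  open import Algebra.Properties.CommutativeSemiring.Exp commutativeSemiring using (_^_)
  open import Algebra.Solver.Ring.NaturalCoefficients.Default commutativeSemiring using (solve; _:+_; _:*_; _:=_)

  lucas : ∀ {s p A B} (β : ℕ → Carrier) → A + B ≈ s → A * B ≈ p →
          β 0 ≈ 1# + 1# → β 1 ≈ s → (∀ m → β (suc (suc m)) ≈ s * β (suc m) - p * β m) →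
          ∀ m → β m ≈ A ^ m + B ^ m
  lucas {s} {p} {A} {B} β A+B≈s A*B≈p β₀ β₁ βₛ = go
    where
    go : ∀ m → β m ≈ A ^ m + B ^ m
    go zero          = β₀
    go (suc zero)    = trans β₁ (trans (sym A+B≈s) (sym (+-cong (*-identityʳ A) (*-identityʳ B))))
    go (suc (suc m)) = begin
      β (suc (suc m))                                        ≈⟨ βₛ m ⟩
      s * β (suc m) - p * β m                                ≈⟨ +-cong (*-cong (sym A+B≈s) (go (suc m))) (-‿cong (*-cong (sym A*B≈p) (go m))) ⟩
      (A + B) * (A * a + B * b) - A * B * (a + b)            ≈⟨ +-congʳ (expand A B a b) ⟩
      (A * (A * a) + B * (B * b)) + A * B * (a + b) - A * B * (a + b) ≈⟨ +-assoc _ _ _ ⟩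
      (A * (A * a) + B * (B * b)) + (A * B * (a + b) - A * B * (a + b)) ≈⟨ +-congˡ (-‿inverseʳ _) ⟩
      (A * (A * a) + B * (B * b)) + 0#                       ≈⟨ +-identityʳ _ ⟩
      A * (A * a) + B * (B * b)                              ∎
      where
      a b : Carrier
      a = A ^ m
      b = B ^ m
      expand : ∀ A B a b → (A + B) * (A * a + B * b) ≈ (A * (A * a) + B * (B * b)) + A * B * (a + b)
      expand = solve 4 (λ A B a b → (A :+ B) :* (A :* a :+ B :* b) := (A :* (A :* a) :+ B :* (B :* b)) :+ A :* B :* (a :+ b)) refl


ℚ-rawRing : RawRing 0ℓ 0ℓ
ℚ-rawRing = CommutativeRing.rawRing ℚ.+-*-commutativeRing

module ℚAlgebra {c ℓ} (R : CommutativeRing c ℓ)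
                (ι : ℚ-rawRing ACR.-Raw-AlmostCommutative⟶ ACR.fromCommutativeRing R) where

  open CommutativeRing R hiding (zero)
  open import Relation.Binary.Reasoning.Setoid setoid
  open import Algebra.Properties.Ring ring using (-0#≈0#)
  open import Algebra.Properties.CommutativeSemiring.Exp commutativeSemiring using (_^_; ^-congˡ; ^-distrib-*)
  open ACR._-Raw-AlmostCommutative⟶_ ι using (1-homo) renaming (⟦_⟧ to ⟦_⟧ℚ)
  open LucasSequence R using (lucas)

  private
    ≟-ι : (x y : ℚ) → Maybe (⟦ x ⟧ℚ ≈ ⟦ y ⟧ℚ)
    ≟-ι x y with x ℚ.≟ y
    ... | yes ≡.refl = just refl
    ... | no  _      = nothing

  open import Algebra.Solver.Ring ℚ-rawRing (ACR.fromCommutativeRing R) ι ≟-ι public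

  two : Carrier
  two = ⟦ 1ℚ ℚ.+ 1ℚ ⟧ℚ

  module NarayanaDiscriminant
    (θ : Carrier → Carrier)
    (θ-+ : ∀ x y → θ (x + y) ≈ θ x + θ y)
    (θ-neg : ∀ x → θ (- x) ≈ - θ x)
    (θ-* : ∀ x y → θ (x * y) ≈ θ x * y + x * θ y)
    (θ-ι : ∀ a → θ ⟦ a ⟧ℚ ≈ 0#)
    (q t G : Carrier) (θq : θ q ≈ q) (θt : θ t ≈ 0#)
    where

    s Δ V D E : Carrier
    s = ⟦ 1ℚ ⟧ℚ - q - t * q
    Δ = s * s - two * two * (t * q * q)
    V = s - two * (t * (q * G))
    D = V * V - Δ
    E = q - s * G + t * q * (G * G)

    private
      θ-- : ∀ x y → θ (x - y) ≈ θ x - θ y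
      θ-- x y = trans (θ-+ x (- y)) (+-congˡ (θ-neg y))

      θ-scale : ∀ k x → θ k ≈ 0# → θ (k * x) ≈ k * θ x
      θ-scale k x θk≈0 = trans (θ-* k x) (trans (+-congʳ (trans (*-congʳ θk≈0) (zeroˡ x))) (+-identityˡ _))

      θ-tq : θ (t * q) ≈ t * q
      θ-tq = trans (θ-scale t q θt) (*-congˡ θq)

    θ-s : θ s ≈ - q - t * q
    θ-s = begin
      θ (⟦ 1ℚ ⟧ℚ - q - t * q)          ≈⟨ trans (θ-- _ _) (+-congʳ (θ-- _ _)) ⟩
      θ ⟦ 1ℚ ⟧ℚ - θ q - θ (t * q)      ≈⟨ +-cong (+-cong (θ-ι 1ℚ) (-‿cong θq)) (-‿cong θ-tq) ⟩
      0# - q - t * q                   ≈⟨ +-congʳ (+-identityˡ _) ⟩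
      - q - t * q                      ∎

    θ-Δ : θ Δ ≈ ((- q - t * q) * s + s * (- q - t * q)) - two * two * (t * q * q + t * q * q)
    θ-Δ = begin
      θ (s * s - two * two * (t * q * q))          ≈⟨ θ-- _ _ ⟩
      θ (s * s) - θ (two * two * (t * q * q))
        ≈⟨ +-cong (trans (θ-* s s) (+-cong (*-congʳ θ-s) (*-congˡ θ-s))) (-‿cong (trans (θ-scale _ _ θ-four) (*-congˡ θ-tqq))) ⟩
      ((- q - t * q) * s + s * (- q - t * q)) - two * two * (t * q * q + t * q * q) ∎
      where
      θ-four : θ (two * two) ≈ 0#
      θ-four = trans (θ-scale two two (θ-ι _)) (trans (*-congˡ (θ-ι _)) (zeroʳ _))
      θ-tqq : θ (t * q * q) ≈ t * q * q + t * q * q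
      θ-tqq = trans (θ-* (t * q) q) (+-cong (*-congʳ θ-tq) (*-congˡ θq))

    θ-V : θ V ≈ (- q - t * q) - two * (t * (q * G + q * θ G))
    θ-V = begin
      θ (s - two * (t * (q * G)))    ≈⟨ θ-- _ _ ⟩
      θ s - θ (two * (t * (q * G)))
        ≈⟨ +-cong θ-s (-‿cong (trans (θ-scale two _ (θ-ι _)) (*-congˡ (trans (θ-scale t _ θt) (*-congˡ θ-qG))))) ⟩
      (- q - t * q) - two * (t * (q * G + q * θ G)) ∎
      where
      θ-qG : θ (q * G) ≈ q * G + q * θ G
      θ-qG = trans (θ-* q G) (+-congʳ (*-congʳ θq))

    V-ode : Δ * θ G + s * G ≈ two * q → two * (Δ * θ V) ≈ θ Δ * V
    V-ode ode = begin
      two * (Δ * θ V)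
        ≈⟨ *-congˡ (*-congˡ θ-V) ⟩
      two * (Δ * ((- q - t * q) - two * (t * (q * G + q * θ G))))
        ≈⟨ solve 4 (λ q t G θG →
             let s = con 1ℚ :- q :- t :* q ; tw = con (1ℚ ℚ.+ 1ℚ) ; Δ = s :* s :- tw :* tw :* (t :* q :* q) in
             tw :* (Δ :* ((:- q :- t :* q) :- tw :* (t :* (q :* G :+ q :* θG))))
             := (((:- q :- t :* q) :* s :+ s :* (:- q :- t :* q)) :- tw :* tw :* (t :* q :* q :+ t :* q :* q)) :* (s :- tw :* (t :* (q :* G)))
                :- tw :* tw :* (t :* q) :* ((Δ :* θG :+ s :* G) :- tw :* q)) refl q t G (θ G) ⟩
      (((- q - t * q) * s + s * (- q - t * q)) - two * two * (t * q * q + t * q * q)) * V - two * two * (t * q) * ((Δ * θ G + s * G) - two * q)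
        ≈⟨ +-cong (*-congʳ (sym θ-Δ)) (-‿cong (*-congˡ (trans (+-congʳ ode) (-‿inverseʳ _)))) ⟩
      θ Δ * V - two * two * (t * q) * 0#
        ≈⟨ trans (+-congˡ (trans (-‿cong (zeroʳ _)) -0#≈0#)) (+-identityʳ _) ⟩
      θ Δ * V ∎

    -- V² and Δ solve the same first-order equation Δ θY = θΔ Y, hence so does their difference.
    D-ode : Δ * θ G + s * G ≈ two * q → Δ * θ D ≈ θ Δ * D
    D-ode ode = begin
      Δ * θ D                             ≈⟨ *-congˡ (trans (θ-- _ _) (+-congʳ (θ-* V V))) ⟩
      Δ * ((θ V * V + V * θ V) - θ Δ)
        ≈⟨ solve 4 (λ Δ θV V θΔ → Δ :* ((θV :* V :+ V :* θV) :- θΔ) := V :* (con (1ℚ ℚ.+ 1ℚ) :* (Δ :* θV)) :- Δ :* θΔ) refl Δ (θ V) V (θ Δ) ⟩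
      V * (two * (Δ * θ V)) - Δ * θ Δ    ≈⟨ +-congʳ (*-congˡ (V-ode ode)) ⟩
      V * (θ Δ * V) - Δ * θ Δ            ≈⟨ solve 3 (λ V Δ θΔ → V :* (θΔ :* V) :- Δ :* θΔ := θΔ :* (V :* V :- Δ)) refl V Δ (θ Δ) ⟩
      θ Δ * D                             ∎

    D≈4tqE : D ≈ two * two * (t * (q * E))
    D≈4tqE = solve 3 (λ q t G →
      let s = con 1ℚ :- q :- t :* q ; tw = con (1ℚ ℚ.+ 1ℚ) ; V = s :- tw :* (t :* (q :* G)) in
      V :* V :- (s :* s :- tw :* tw :* (t :* q :* q)) := tw :* tw :* (t :* (q :* (q :- s :* G :+ t :* q :* (G :* G))))) refl q t G

    E-normal : E ≈ q - (1# - q - t * q) * G + t * q * (G * G)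
    E-normal = +-congʳ (+-congˡ (-‿cong (*-congʳ (+-congʳ (+-congʳ 1-homo)))))

  -- With A = tqG and B = s − A one has A + B = s, AB = tq², BG = q and AG = tqG².
  lucas-power : ∀ {s q t G} (β : ℕ → Carrier) → q - s * G + t * q * (G * G) ≈ 0# →
                β 0 ≈ 1# + 1# → β 1 ≈ s → (∀ m → β (suc (suc m)) ≈ s * β (suc m) - t * q * q * β m) →
                ∀ m → β m * G ^ m ≈ q ^ m + t ^ m * q ^ m * (G ^ m * G ^ m)
  lucas-power {s} {q} {t} {G} β E≈0 β₀ β₁ βₛ m = begin
    β m * G ^ m                                ≈⟨ *-congʳ (lucas β A+B≈s A*B≈tqq β₀ β₁ βₛ m) ⟩
    (A ^ m + B ^ m) * G ^ m                    ≈⟨ distribʳ _ _ _ ⟩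
    A ^ m * G ^ m + B ^ m * G ^ m              ≈⟨ +-comm _ _ ⟩
    B ^ m * G ^ m + A ^ m * G ^ m              ≈⟨ +-cong (sym (^-distrib-* B G m)) (sym (^-distrib-* A G m)) ⟩
    (B * G) ^ m + (A * G) ^ m                  ≈⟨ +-cong (^-congˡ m B*G≈q) (^-congˡ m A*G≈tqGG) ⟩
    q ^ m + (t * q * (G * G)) ^ m              ≈⟨ +-congˡ (trans (^-distrib-* (t * q) (G * G) m) (*-cong (^-distrib-* t q m) (^-distrib-* G G m))) ⟩
    q ^ m + t ^ m * q ^ m * (G ^ m * G ^ m)    ∎
    where
    A B : Carrier
    A = t * q * G
    B = s - A
    A+B≈s : A + B ≈ s
    A+B≈s = solve 2 (λ A s → A :+ (s :- A) := s) refl A s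
    B*G≈q : B * G ≈ q
    B*G≈q = begin
      B * G                                     ≈⟨ solve 4 (λ q t G s → (s :- t :* q :* G) :* G := q :- (q :- s :* G :+ t :* q :* (G :* G))) refl q t G s ⟩
      q - (q - s * G + t * q * (G * G))         ≈⟨ +-congˡ (trans (-‿cong E≈0) -0#≈0#) ⟩
      q + 0#                                    ≈⟨ +-identityʳ q ⟩
      q                                         ∎
    A*B≈tqq : A * B ≈ t * q * q
    A*B≈tqq = trans (solve 4 (λ t q G B → t :* q :* G :* B := t :* q :* (B :* G)) refl t q G B) (*-congˡ B*G≈q)
    A*G≈tqGG : A * G ≈ t * q * (G * G)
    A*G≈tqGG = *-assoc (t * q) G G


ℚ-ring : AlmostCommutativeRing _ _
ℚ-ring = fromCommutativeRing ℚ.+-*-commutativeRing 0≟_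
  where
  0≟_ : ∀ x → Maybe (0ℚ ≡ x)
  0≟ x with 0ℚ ℚ.≟ x
  ... | yes 0≡x = just 0≡x
  ... | no  _   = nothing

module Casts where

  open import Data.Integer.Tactic.RingSolver using (solve-∀)

  private
    fromℚᵘ-+ : ∀ p q → ℚ.fromℚᵘ (p ℚᵘ.+ q) ≡ ℚ.fromℚᵘ p ℚ.+ ℚ.fromℚᵘ q
    fromℚᵘ-+ p q = ℚ.toℚᵘ-injective (ℚᵘ.≃-trans (ℚ.toℚᵘ-fromℚᵘ _)
      (ℚᵘ.≃-sym (ℚᵘ.≃-trans (ℚ.toℚᵘ-homo-+ (ℚ.fromℚᵘ p) (ℚ.fromℚᵘ q)) (ℚᵘ.+-cong (ℚ.toℚᵘ-fromℚᵘ p) (ℚ.toℚᵘ-fromℚᵘ q)))))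

    fromℚᵘ-* : ∀ p q → ℚ.fromℚᵘ (p ℚᵘ.* q) ≡ ℚ.fromℚᵘ p ℚ.* ℚ.fromℚᵘ q
    fromℚᵘ-* p q = ℚ.toℚᵘ-injective (ℚᵘ.≃-trans (ℚ.toℚᵘ-fromℚᵘ _)
      (ℚᵘ.≃-sym (ℚᵘ.≃-trans (ℚ.toℚᵘ-homo-* (ℚ.fromℚᵘ p) (ℚ.fromℚᵘ q)) (ℚᵘ.*-cong (ℚ.toℚᵘ-fromℚᵘ p) (ℚ.toℚᵘ-fromℚᵘ q)))))

  ιℤ : ℤ → ℚ
  ιℤ a = a ℚ./ 1

  ι : ℕ → ℚ
  ι n = ιℤ (+ n)

  ιℤ-+ : ∀ a b → ιℤ (a ℤ.+ b) ≡ ιℤ a ℚ.+ ιℤ b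
  ιℤ-+ a b = ≡.trans (ℚ.fromℚᵘ-cong {mkℚᵘ (a ℤ.+ b) 0} {mkℚᵘ a 0 ℚᵘ.+ mkℚᵘ b 0} (*≡* (lemma a b))) (fromℚᵘ-+ (mkℚᵘ a 0) (mkℚᵘ b 0))
    where
    lemma : ∀ a b → (a ℤ.+ b) ℤ.* (+ 1 ℤ.* + 1) ≡ (a ℤ.* + 1 ℤ.+ b ℤ.* + 1) ℤ.* + 1
    lemma = solve-∀

  ιℤ-* : ∀ a b → ιℤ (a ℤ.* b) ≡ ιℤ a ℚ.* ιℤ b
  ιℤ-* a b = ≡.trans (ℚ.fromℚᵘ-cong {mkℚᵘ (a ℤ.* b) 0} {mkℚᵘ a 0 ℚᵘ.* mkℚᵘ b 0} (*≡* (lemma a b))) (fromℚᵘ-* (mkℚᵘ a 0) (mkℚᵘ b 0))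
    where
    lemma : ∀ a b → (a ℤ.* b) ℤ.* (+ 1 ℤ.* + 1) ≡ (a ℤ.* b) ℤ.* + 1
    lemma = solve-∀

  ι-+ : ∀ m n → ι (m ℕ.+ n) ≡ ι m ℚ.+ ι n
  ι-+ m n = ιℤ-+ (+ m) (+ n)

  ι-* : ∀ m n → ι (m ℕ.* n) ≡ ι m ℚ.* ι n
  ι-* m n = ≡.trans (≡.cong ιℤ (ℤ.pos-* m n)) (ιℤ-* (+ m) (+ n))

  /-*-ι : ∀ a d → (a ℚ./ suc d) ℚ.* ι (suc d) ≡ ιℤ a
  /-*-ι a d = ≡.trans (≡.sym (fromℚᵘ-* (mkℚᵘ a d) (mkℚᵘ (+ suc d) 0)))
                      (ℚ.fromℚᵘ-cong {mkℚᵘ a d ℚᵘ.* mkℚᵘ (+ suc d) 0} {mkℚᵘ a 0} (*≡* (lemma a (+ suc d))))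
    where
    lemma : ∀ a e → (a ℤ.* e) ℤ.* + 1 ≡ a ℤ.* (e ℤ.* + 1)
    lemma = solve-∀

  *-cancelʳ-ι : ∀ {x y} n → x ℚ.* ι (suc n) ≡ y ℚ.* ι (suc n) → x ≡ y
  *-cancelʳ-ι {x} {y} n eq = begin
    x                                  ≡⟨ ≡.sym (ℚ.*-identityʳ x) ⟩
    x ℚ.* 1ℚ                           ≡⟨ ≡.cong (x ℚ.*_) ι*inv≡1 ⟨
    x ℚ.* (ι (suc n) ℚ.* inv)          ≡⟨ ℚ.*-assoc x _ inv ⟨
    (x ℚ.* ι (suc n)) ℚ.* inv          ≡⟨ ≡.cong (ℚ._* inv) eq ⟩
    (y ℚ.* ι (suc n)) ℚ.* inv          ≡⟨ ℚ.*-assoc y _ inv ⟩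
    y ℚ.* (ι (suc n) ℚ.* inv)          ≡⟨ ≡.cong (y ℚ.*_) ι*inv≡1 ⟩
    y ℚ.* 1ℚ                           ≡⟨ ℚ.*-identityʳ y ⟩
    y                                  ∎
    where
    open ≡.≡-Reasoning
    inv : ℚ
    inv = + 1 ℚ./ suc n
    ι*inv≡1 : ι (suc n) ℚ.* inv ≡ 1ℚ
    ι*inv≡1 = ≡.trans (≡.sym (fromℚᵘ-* (mkℚᵘ (+ suc n) 0) (mkℚᵘ (+ 1) n)))
                      (ℚ.fromℚᵘ-cong {mkℚᵘ (+ suc n) 0 ℚᵘ.* mkℚᵘ (+ 1) n} {mkℚᵘ (+ 1) 0} (*≡* (lemma (+ suc n))))
      where
      lemma : ∀ e → (e ℤ.* + 1) ℤ.* + 1 ≡ + 1 ℤ.* (+ 1 ℤ.* e)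
      lemma = solve-∀

  *ι≡0⇒≡0 : ∀ {x} n → x ℚ.* ι (suc n) ≡ 0ℚ → x ≡ 0ℚ
  *ι≡0⇒≡0 n x*ι≡0 = *-cancelʳ-ι n (≡.trans x*ι≡0 (≡.sym (ℚ.*-zeroˡ (ι (suc n)))))

module Binomial where

  open import Data.Nat using (_*_; _+_)
  open import Data.Nat.Combinatorics using (nCk≡n!/k![n-k]!; k![n∸k]!∣n!)
  open import Data.Nat.Properties using (_!*_!≢0)
  open import Data.Nat.DivMod using (m/n*n≡m)
  open import Data.Nat.Tactic.RingSolver using (solve-∀)
  open ≡.≡-Reasoning

  private
    C*factorials : ∀ {n k} → k ≤ n → (n C k) * (k ! * (n ∸ k) !) ≡ n !
    C*factorials {n} {k} k≤n = ≡.trans (≡.cong (_* (k ! * (n ∸ k) !)) (nCk≡n!/k![n-k]! k≤n)) (m/n*n≡m (k![n∸k]!∣n! k≤n))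
      where instance _ = k !* (n ∸ k) !≢0

  absorption : ∀ n k → suc k * (suc n C suc k) ≡ suc n * (n C k)
  absorption n k with k ℕ.≤? n
  ... | yes k≤n = ℕ.*-cancelʳ-≡ _ _ (k ! * (n ∸ k) !) (begin
      suc k * (suc n C suc k) * (k ! * (n ∸ k) !)  ≡⟨ regroup (suc k) (suc n C suc k) (k !) ((n ∸ k) !) ⟩
      (suc n C suc k) * (suc k * k ! * (n ∸ k) !)  ≡⟨ C*factorials (s≤s k≤n) ⟩
      suc n * n !                                  ≡⟨ ≡.cong (suc n *_) (C*factorials k≤n) ⟨
      suc n * ((n C k) * (k ! * (n ∸ k) !))        ≡⟨ ℕ.*-assoc (suc n) (n C k) _ ⟨
      suc n * (n C k) * (k ! * (n ∸ k) !)          ∎)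
    where
    instance _ = k !* (n ∸ k) !≢0
    regroup : ∀ a b c d → a * b * (c * d) ≡ b * (a * c * d)
    regroup = solve-∀
  ... | no k≰n = begin
      suc k * (suc n C suc k)   ≡⟨ ≡.cong (suc k *_) (k>n⇒nCk≡0 (s≤s (ℕ.≰⇒> k≰n))) ⟩
      suc k * 0                 ≡⟨ ℕ.*-zeroʳ (suc k) ⟩
      0                         ≡⟨ ℕ.*-zeroʳ (suc n) ⟨
      suc n * 0                 ≡⟨ ≡.cong (suc n *_) (k>n⇒nCk≡0 (ℕ.≰⇒> k≰n)) ⟨
      suc n * (n C k)           ∎

  -- (k + 1) C(n, k + 1) = (n − k) C(n, k), with the subtraction moved to the left.
  absorption-lower : ∀ n k → suc k * (n C suc k) + k * (n C k) ≡ n * (n C k)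
  absorption-lower n k = ℕ.+-cancelʳ-≡ _ _ _ (begin
    (suc k * (n C suc k) + k * (n C k)) + n C k      ≡⟨ regroup k (n C suc k) (n C k) ⟩
    suc k * (n C k + n C suc k)                      ≡⟨ ≡.cong (suc k *_) (nCk+nC[k+1]≡[n+1]C[k+1] n k) ⟩
    suc k * (suc n C suc k)                          ≡⟨ absorption n k ⟩
    suc n * (n C k)                                  ≡⟨ ℕ.+-comm (n C k) (n * (n C k)) ⟩
    n * (n C k) + n C k                              ∎)
    where
    regroup : ∀ k b d → (suc k * b + k * d) + d ≡ suc k * (d + b)
    regroup = solve-∀


ℚ[[t]] : CommutativeRing 0ℓ 0ℓ
ℚ[[t]] = PowerSeries.commutativeRing ℚ.+-*-commutativeRing

ℚ[[t]][[q]] : CommutativeRing 0ℓ 0ℓ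
ℚ[[t]][[q]] = PowerSeries.commutativeRing ℚ[[t]]

module Bivariate where

  open import Defs using (PS; Σ≤; psOne; psMul; psPow; tPow)

  module T = PowerSeries ℚ.+-*-commutativeRing
  module Q = PowerSeries ℚ[[t]]

  open CommutativeRing ℚ[[t]][[q]] public hiding (zero)
  open import Algebra.Properties.CommutativeSemiring.Exp commutativeSemiring public using (_^_)

  q t : PS
  q = Q.X
  t = Q.const T.X

  shiftQ shiftT : PS → PS
  shiftQ     = Q.shift
  shiftT f n = T.shift (f n)

  ιℚ : ℚ-rawRing ACR.-Raw-AlmostCommutative⟶ ACR.fromCommutativeRing ℚ[[t]][[q]]
  ιℚ = record
    { ⟦_⟧    = λ a → Q.const (T.const a)
    ; +-homo = λ a b → trans (Q.const-cong (T.const-+ a b)) (Q.const-+ _ _)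
    ; *-homo = λ a b → trans (Q.const-cong (T.const-* a b)) (Q.const-* _ _)
    ; -‿homo = λ a → trans (Q.const-cong (T.const-neg a)) (Q.const-neg _)
    ; 0-homo = trans (Q.const-cong T.const-0) Q.const-0
    ; 1-homo = refl
    }

  open ℚAlgebra ℚ[[t]][[q]] ιℚ public using (solve; _:+_; _:-_; _:*_; _:=_; con; two)

  q*≈shiftQ : ∀ f → q * f ≈ shiftQ f
  q*≈shiftQ = Q.X-*ₛ

  t*≈shiftT : ∀ f → t * f ≈ shiftT f
  t*≈shiftT f n k = ≡.trans (Q.const-*ₛ T.X f n k) (T.X-*ₛ (f n) k)

  shiftQ-cong : ∀ {f f′} → f ≈ f′ → shiftQ f ≈ shiftQ f′
  shiftQ-cong f≈f′ zero    k = ≡.refl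
  shiftQ-cong f≈f′ (suc n) k = f≈f′ n k

  shiftT-cong : ∀ {f f′} → f ≈ f′ → shiftT f ≈ shiftT f′
  shiftT-cong f≈f′ n zero    = ≡.refl
  shiftT-cong f≈f′ n (suc k) = f≈f′ n k

  ∑≡Σ≤ : ∀ n f → T.∑ n f ≡ Σ≤ n f
  ∑≡Σ≤ zero    f = ≡.refl
  ∑≡Σ≤ (suc n) f = ≡.cong (ℚ._+ f (suc n)) (∑≡Σ≤ n f)

  ∑-coefficient : ∀ n (H : PS) k → Q.∑ n H k ≡ T.∑ n (λ a → H a k)
  ∑-coefficient zero    H k = ≡.refl
  ∑-coefficient (suc n) H k = ≡.cong (ℚ._+ H (suc n) k) (∑-coefficient n H k)

  psMul≈* : ∀ f g → psMul f g ≈ f * g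
  psMul≈* f g n k = ≡.sym (≡.trans (∑-coefficient n _ k) (≡.trans (T.∑-congᵘ n (λ a → ∑≡Σ≤ k _)) (∑≡Σ≤ n _)))

  psOne≈1 : psOne ≈ 1#
  psOne≈1 zero    zero    = ≡.refl
  psOne≈1 zero    (suc k) = ≡.refl
  psOne≈1 (suc n) zero    = ≡.refl
  psOne≈1 (suc n) (suc k) = ≡.refl

  psPow≈^ : ∀ f m → psPow f m ≈ f ^ m
  psPow≈^ f zero    = psOne≈1
  psPow≈^ f (suc m) = trans (psMul≈* f (psPow f m)) (*-cong {f} {f} {psPow f m} {f ^ m} (refl {f}) (psPow≈^ f m))

  private
    tPow-suc : ∀ m k → tPow (suc m) zero (suc k) ≡ tPow m zero k
    tPow-suc m k with suc k ℕ.≟ suc m | k ℕ.≟ m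
    ... | yes _   | yes _   = ≡.refl
    ... | no _    | no _    = ≡.refl
    ... | yes k≡m | no k≢m  = ⊥-elim (k≢m (ℕ.suc-injective k≡m))
    ... | no k≢m  | yes k≡m = ⊥-elim (k≢m (≡.cong suc k≡m))

    tPow-suc-0 : ∀ m → tPow (suc m) zero zero ≡ 0ℚ
    tPow-suc-0 m with zero ℕ.≟ suc m
    ... | no _ = ≡.refl

  tPow≈t^ : ∀ m → tPow m ≈ t ^ m
  tPow≈t^ zero    zero    zero    = ≡.refl
  tPow≈t^ zero    zero    (suc k) = ≡.refl
  tPow≈t^ zero    (suc n) k       = ≡.refl
  tPow≈t^ (suc m) n k = ≡.sym (≡.trans (t*≈shiftT (t ^ m) n k) (shifted n k))
    where
    shifted : ∀ n k → shiftT (t ^ m) n k ≡ tPow (suc m) n k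
    shifted zero    zero    = ≡.sym (tPow-suc-0 m)
    shifted zero    (suc k) = ≡.sym (≡.trans (tPow-suc m k) (tPow≈t^ m zero k))
    shifted (suc n) zero    = ≡.refl
    shifted (suc n) (suc k) = ≡.sym (tPow≈t^ m (suc n) k)


module NarayanaNumbers where

  open Tactic.RingSolver using (solve-∀)
  open import Defs using (narayanaCoef)

  open Casts
  open ≡.≡-Reasoning

  binom : ℕ → ℕ → ℚ
  binom n k = ι (n C k)

  absorptionℚ : ∀ n k → ι (suc k) ℚ.* binom (suc n) (suc k) ≡ ι (suc n) ℚ.* binom n k
  absorptionℚ n k = begin
    ι (suc k) ℚ.* binom (suc n) (suc k)   ≡⟨ ι-* (suc k) (suc n C suc k) ⟨
    ι (suc k ℕ.* (suc n C suc k))         ≡⟨ ≡.cong ι (Binomial.absorption n k) ⟩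
    ι (suc n ℕ.* (n C k))                 ≡⟨ ι-* (suc n) (n C k) ⟩
    ι (suc n) ℚ.* binom n k               ∎

  absorption-lowerℚ : ∀ n k → ι (suc k) ℚ.* binom n (suc k) ≡ (ι n ℚ.- ι k) ℚ.* binom n k
  absorption-lowerℚ n k = begin
    ι (suc k) ℚ.* binom n (suc k)                                    ≡⟨ add-sub (ι (suc k) ℚ.* binom n (suc k)) (ι k ℚ.* binom n k) ⟩
    (ι (suc k) ℚ.* binom n (suc k) ℚ.+ ι k ℚ.* binom n k) ℚ.- ι k ℚ.* binom n k ≡⟨ ≡.cong (ℚ._- ι k ℚ.* binom n k) ιsum ⟩
    ι n ℚ.* binom n k ℚ.- ι k ℚ.* binom n k                          ≡⟨ factor (ι n) (ι k) (binom n k) ⟩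
    (ι n ℚ.- ι k) ℚ.* binom n k                                      ∎
    where
    add-sub : ∀ a b → a ≡ (a ℚ.+ b) ℚ.- b
    add-sub = solve-∀ ℚ-ring
    factor : ∀ a b c → a ℚ.* c ℚ.- b ℚ.* c ≡ (a ℚ.- b) ℚ.* c
    factor = solve-∀ ℚ-ring
    ιsum : ι (suc k) ℚ.* binom n (suc k) ℚ.+ ι k ℚ.* binom n k ≡ ι n ℚ.* binom n k
    ιsum = begin
      ι (suc k) ℚ.* binom n (suc k) ℚ.+ ι k ℚ.* binom n k      ≡⟨ ≡.cong₂ ℚ._+_ (ι-* (suc k) (n C suc k)) (ι-* k (n C k)) ⟨
      ι (suc k ℕ.* (n C suc k)) ℚ.+ ι (k ℕ.* (n C k))          ≡⟨ ι-+ (suc k ℕ.* (n C suc k)) (k ℕ.* (n C k)) ⟨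
      ι (suc k ℕ.* (n C suc k) ℕ.+ k ℕ.* (n C k))              ≡⟨ ≡.cong ι (Binomial.absorption-lower n k) ⟩
      ι (n ℕ.* (n C k))                                        ≡⟨ ι-* n (n C k) ⟩
      ι n ℚ.* binom n k                                        ∎

  absorption-upperℚ : ∀ n k → (ι (suc n) ℚ.- ι k) ℚ.* binom (suc n) k ≡ ι (suc n) ℚ.* binom n k
  absorption-upperℚ n k = ≡.trans (≡.sym (absorption-lowerℚ (suc n) k)) (absorptionℚ n k)

  -- Nar x κ is the Narayana number N(x + 1, κ).
  Nar : ℕ → ℕ → ℚ
  Nar x κ = (+ ((suc x C κ) ℕ.* (x C κ))) ℚ./ suc κ

  narayanaCoef-suc : ∀ x κ → narayanaCoef (suc x) κ ≡ Nar x κ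
  narayanaCoef-suc x κ with κ ℕ.≤? x
  ... | yes _   = ≡.refl
  ... | no  κ≰x = ≡.sym (begin
    Nar x κ                                   ≡⟨ ≡.cong (λ c → (+ ((suc x C κ) ℕ.* c)) ℚ./ suc κ) (k>n⇒nCk≡0 (ℕ.≰⇒> κ≰x)) ⟩
    (+ ((suc x C κ) ℕ.* 0)) ℚ./ suc κ         ≡⟨ ≡.cong (λ c → (+ c) ℚ./ suc κ) (ℕ.*-zeroʳ (suc x C κ)) ⟩
    (+ 0) ℚ./ suc κ                           ≡⟨ ℚ.0/n≡0 (suc κ) ⟩
    0ℚ                                        ∎)

  Nar-scaled : ∀ x κ → Nar x κ ℚ.* ι (suc κ) ≡ binom (suc x) κ ℚ.* binom x κ
  Nar-scaled x κ = ≡.trans (/-*-ι (+ ((suc x C κ) ℕ.* (x C κ))) κ) (ι-* (suc x C κ) (x C κ))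

  private
    cancel : ∀ {a b} κ → a ℚ.* ι (suc κ) ≡ b ℚ.* ι (suc κ) → a ≡ b
    cancel = *-cancelʳ-ι

  Nar-ratio-t : ∀ x κ → ι (suc κ) ℚ.* ι (suc (suc κ)) ℚ.* Nar x (suc κ)
                    ≡ (ι (suc x) ℚ.- ι κ) ℚ.* (ι x ℚ.- ι κ) ℚ.* Nar x κ
  Nar-ratio-t x κ = cancel κ (begin
    ι (suc κ) ℚ.* ι (suc (suc κ)) ℚ.* Nar x (suc κ) ℚ.* ι (suc κ)
      ≡⟨ regroup₁ (ι (suc κ)) (ι (suc (suc κ))) (Nar x (suc κ)) ⟩
    ι (suc κ) ℚ.* ι (suc κ) ℚ.* (Nar x (suc κ) ℚ.* ι (suc (suc κ)))
      ≡⟨ ≡.cong (ι (suc κ) ℚ.* ι (suc κ) ℚ.*_) (Nar-scaled x (suc κ)) ⟩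
    ι (suc κ) ℚ.* ι (suc κ) ℚ.* (binom (suc x) (suc κ) ℚ.* binom x (suc κ))
      ≡⟨ regroup₂ (ι (suc κ)) (binom (suc x) (suc κ)) (binom x (suc κ)) ⟩
    (ι (suc κ) ℚ.* binom (suc x) (suc κ)) ℚ.* (ι (suc κ) ℚ.* binom x (suc κ))
      ≡⟨ ≡.cong₂ ℚ._*_ (absorptionℚ x κ) (absorption-lowerℚ x κ) ⟩
    (ι (suc x) ℚ.* binom x κ) ℚ.* ((ι x ℚ.- ι κ) ℚ.* binom x κ)
      ≡⟨ ≡.cong (ℚ._* ((ι x ℚ.- ι κ) ℚ.* binom x κ)) (absorption-upperℚ x κ) ⟨
    ((ι (suc x) ℚ.- ι κ) ℚ.* binom (suc x) κ) ℚ.* ((ι x ℚ.- ι κ) ℚ.* binom x κ)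
      ≡⟨ regroup₃ (ι (suc x) ℚ.- ι κ) (ι x ℚ.- ι κ) (binom (suc x) κ) (binom x κ) ⟩
    (ι (suc x) ℚ.- ι κ) ℚ.* (ι x ℚ.- ι κ) ℚ.* (binom (suc x) κ ℚ.* binom x κ)
      ≡⟨ ≡.cong ((ι (suc x) ℚ.- ι κ) ℚ.* (ι x ℚ.- ι κ) ℚ.*_) (Nar-scaled x κ) ⟨
    (ι (suc x) ℚ.- ι κ) ℚ.* (ι x ℚ.- ι κ) ℚ.* (Nar x κ ℚ.* ι (suc κ))
      ≡⟨ ℚ.*-assoc ((ι (suc x) ℚ.- ι κ) ℚ.* (ι x ℚ.- ι κ)) (Nar x κ) (ι (suc κ)) ⟨
    (ι (suc x) ℚ.- ι κ) ℚ.* (ι x ℚ.- ι κ) ℚ.* Nar x κ ℚ.* ι (suc κ) ∎)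
    where
    regroup₁ : ∀ a b n → a ℚ.* b ℚ.* n ℚ.* a ≡ a ℚ.* a ℚ.* (n ℚ.* b)
    regroup₁ = solve-∀ ℚ-ring
    regroup₂ : ∀ a c d → a ℚ.* a ℚ.* (c ℚ.* d) ≡ (a ℚ.* c) ℚ.* (a ℚ.* d)
    regroup₂ = solve-∀ ℚ-ring
    regroup₃ : ∀ u v c d → (u ℚ.* c) ℚ.* (v ℚ.* d) ≡ u ℚ.* v ℚ.* (c ℚ.* d)
    regroup₃ = solve-∀ ℚ-ring

  Nar-ratio-q : ∀ x κ → (ι (suc (suc x)) ℚ.- ι κ) ℚ.* (ι (suc x) ℚ.- ι κ) ℚ.* Nar (suc x) κ
                    ≡ ι (suc (suc x)) ℚ.* ι (suc x) ℚ.* Nar x κ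
  Nar-ratio-q x κ = cancel κ (begin
    u ℚ.* v ℚ.* Nar (suc x) κ ℚ.* ι (suc κ)
      ≡⟨ ℚ.*-assoc (u ℚ.* v) (Nar (suc x) κ) (ι (suc κ)) ⟩
    u ℚ.* v ℚ.* (Nar (suc x) κ ℚ.* ι (suc κ))
      ≡⟨ ≡.cong (u ℚ.* v ℚ.*_) (Nar-scaled (suc x) κ) ⟩
    u ℚ.* v ℚ.* (binom (suc (suc x)) κ ℚ.* binom (suc x) κ)
      ≡⟨ regroup u v (binom (suc (suc x)) κ) (binom (suc x) κ) ⟩
    (u ℚ.* binom (suc (suc x)) κ) ℚ.* (v ℚ.* binom (suc x) κ)
      ≡⟨ ≡.cong₂ ℚ._*_ (absorption-upperℚ (suc x) κ) (absorption-upperℚ x κ) ⟩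
    (ι (suc (suc x)) ℚ.* binom (suc x) κ) ℚ.* (ι (suc x) ℚ.* binom x κ)
      ≡⟨ regroup (ι (suc (suc x))) (ι (suc x)) (binom (suc x) κ) (binom x κ) ⟨
    ι (suc (suc x)) ℚ.* ι (suc x) ℚ.* (binom (suc x) κ ℚ.* binom x κ)
      ≡⟨ ≡.cong (ι (suc (suc x)) ℚ.* ι (suc x) ℚ.*_) (Nar-scaled x κ) ⟨
    ι (suc (suc x)) ℚ.* ι (suc x) ℚ.* (Nar x κ ℚ.* ι (suc κ))
      ≡⟨ ℚ.*-assoc (ι (suc (suc x)) ℚ.* ι (suc x)) (Nar x κ) (ι (suc κ)) ⟨
    ι (suc (suc x)) ℚ.* ι (suc x) ℚ.* Nar x κ ℚ.* ι (suc κ) ∎)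
    where
    u v : ℚ
    u = ι (suc (suc x)) ℚ.- ι κ
    v = ι (suc x) ℚ.- ι κ
    regroup : ∀ u v c d → u ℚ.* v ℚ.* (c ℚ.* d) ≡ (u ℚ.* c) ℚ.* (v ℚ.* d)
    regroup = solve-∀ ℚ-ring


module NarayanaRecurrence where

  open Tactic.RingSolver using (solve-∀)

  open Casts
  open NarayanaNumbers

  -- Coefficient of q^n t^k in Δ·θG + s·G, where Δ = 1 − 2q − 2tq + q² − 2tq² + t²q² and s = 1 − q − tq,
  -- from the coefficients z of θG and f of G at (n, k), (n−1, k), (n−1, k−1), (n−2, k), (n−2, k−1), (n−2, k−2).
  odeTerms : (z z₁ z₁′ z₂ z₂′ z₂″ f f₁ f₁′ : ℚ) → ℚ
  odeTerms z z₁ z₁′ z₂ z₂′ z₂″ f f₁ f₁′ =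
    z ℚ.- (z₁ ℚ.+ z₁) ℚ.- (z₁′ ℚ.+ z₁′) ℚ.+ z₂ ℚ.- (z₂′ ℚ.+ z₂′) ℚ.+ z₂″ ℚ.+ f ℚ.- f₁ ℚ.- f₁′

  private
    ι-suc : ∀ n → ι (suc n) ≡ 1ℚ ℚ.+ ι n
    ι-suc n = ι-+ 1 n

    certificate : ∀ ν κ A B₁ B₂ C₁ C₂ C₃ →
      let n₁ = 1ℚ ℚ.+ ν ; n₂ = 1ℚ ℚ.+ n₁ ; n₃ = 1ℚ ℚ.+ n₂
          k₁ = 1ℚ ℚ.+ κ ; k₂ = 1ℚ ℚ.+ k₁ ; k₃ = 1ℚ ℚ.+ k₂ in
      (n₃ ℚ.* A ℚ.- (n₂ ℚ.* B₁ ℚ.+ n₂ ℚ.* B₁) ℚ.- (n₂ ℚ.* B₂ ℚ.+ n₂ ℚ.* B₂) ℚ.+ n₁ ℚ.* C₁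
        ℚ.- (n₁ ℚ.* C₂ ℚ.+ n₁ ℚ.* C₂) ℚ.+ n₁ ℚ.* C₃ ℚ.+ A ℚ.- B₁ ℚ.- B₂) ℚ.* k₁ ℚ.* k₂ ℚ.* k₂ ℚ.* k₃
      ≡ (n₃ ℚ.+ 1ℚ) ℚ.* k₁ ℚ.* k₂ ℚ.* (k₂ ℚ.* k₃ ℚ.* A ℚ.- n₃ ℚ.* n₂ ℚ.* B₂)
        ℚ.+ ℚ.- (n₂ ℚ.+ n₃) ℚ.* k₁ ℚ.* k₂ ℚ.* (k₂ ℚ.* k₃ ℚ.* B₁ ℚ.- (n₂ ℚ.- k₁) ℚ.* (n₁ ℚ.- k₁) ℚ.* B₂)
        ℚ.+ n₁ ℚ.* k₁ ℚ.* k₂ ℚ.* (k₂ ℚ.* k₃ ℚ.* C₁ ℚ.- (n₁ ℚ.- k₁) ℚ.* (ν ℚ.- k₁) ℚ.* C₂)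
        ℚ.+ ((n₃ ℚ.+ 1ℚ) ℚ.* n₃ ℚ.* n₂ ℚ.- (n₂ ℚ.+ n₃) ℚ.* ((n₂ ℚ.- k₁) ℚ.* (n₁ ℚ.- k₁) ℚ.+ k₂ ℚ.* k₃))
            ℚ.* (k₁ ℚ.* k₂ ℚ.* B₂ ℚ.- n₂ ℚ.* n₁ ℚ.* C₃)
        ℚ.+ (n₁ ℚ.* (n₁ ℚ.- k₁) ℚ.* (ν ℚ.- k₁) ℚ.- (n₁ ℚ.+ n₁) ℚ.* k₂ ℚ.* k₃)
            ℚ.* (k₁ ℚ.* k₂ ℚ.* C₂ ℚ.- (n₁ ℚ.- κ) ℚ.* (ν ℚ.- κ) ℚ.* C₃)
    certificate = solve-∀ ℚ-ring

    combination≡0 : ∀ {x₁ y₁ x₂ y₂ x₃ y₃ x₄ y₄ x₅ y₅} c₁ c₂ c₃ c₄ c₅ →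
                    x₁ ≡ y₁ → x₂ ≡ y₂ → x₃ ≡ y₃ → x₄ ≡ y₄ → x₅ ≡ y₅ →
                    c₁ ℚ.* (x₁ ℚ.- y₁) ℚ.+ c₂ ℚ.* (x₂ ℚ.- y₂) ℚ.+ c₃ ℚ.* (x₃ ℚ.- y₃)
                      ℚ.+ c₄ ℚ.* (x₄ ℚ.- y₄) ℚ.+ c₅ ℚ.* (x₅ ℚ.- y₅) ≡ 0ℚ
    combination≡0 {y₁ = y₁} {y₂ = y₂} {y₃ = y₃} {y₄ = y₄} {y₅ = y₅} c₁ c₂ c₃ c₄ c₅ ≡.refl ≡.refl ≡.refl ≡.refl ≡.refl =
      cancels c₁ c₂ c₃ c₄ c₅ y₁ y₂ y₃ y₄ y₅
      where
      cancels : ∀ c₁ c₂ c₃ c₄ c₅ y₁ y₂ y₃ y₄ y₅ →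
                c₁ ℚ.* (y₁ ℚ.- y₁) ℚ.+ c₂ ℚ.* (y₂ ℚ.- y₂) ℚ.+ c₃ ℚ.* (y₃ ℚ.- y₃)
                  ℚ.+ c₄ ℚ.* (y₄ ℚ.- y₄) ℚ.+ c₅ ℚ.* (y₅ ℚ.- y₅) ≡ 0ℚ
      cancels = solve-∀ ℚ-ring

  -- The certificate exhibits the recurrence, multiplied by (κ+1)(κ+2)²(κ+3), as a combination of
  -- the five ratio relations between neighbouring Narayana numbers.
  recurrence-from-ratios : ∀ {n₁ n₂ n₃ k₁ k₂ k₃} ν κ A B₁ B₂ C₁ C₂ C₃ →
    n₁ ≡ 1ℚ ℚ.+ ν → n₂ ≡ 1ℚ ℚ.+ n₁ → n₃ ≡ 1ℚ ℚ.+ n₂ → k₁ ≡ 1ℚ ℚ.+ κ → k₂ ≡ 1ℚ ℚ.+ k₁ → k₃ ≡ 1ℚ ℚ.+ k₂ →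
    k₂ ℚ.* k₃ ℚ.* A ≡ n₃ ℚ.* n₂ ℚ.* B₂ →
    k₂ ℚ.* k₃ ℚ.* B₁ ≡ (n₂ ℚ.- k₁) ℚ.* (n₁ ℚ.- k₁) ℚ.* B₂ →
    k₂ ℚ.* k₃ ℚ.* C₁ ≡ (n₁ ℚ.- k₁) ℚ.* (ν ℚ.- k₁) ℚ.* C₂ →
    k₁ ℚ.* k₂ ℚ.* B₂ ≡ n₂ ℚ.* n₁ ℚ.* C₃ →
    k₁ ℚ.* k₂ ℚ.* C₂ ≡ (n₁ ℚ.- κ) ℚ.* (ν ℚ.- κ) ℚ.* C₃ →
    odeTerms (n₃ ℚ.* A) (n₂ ℚ.* B₁) (n₂ ℚ.* B₂) (n₁ ℚ.* C₁) (n₁ ℚ.* C₂) (n₁ ℚ.* C₃) A B₁ B₂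
      ℚ.* k₁ ℚ.* k₂ ℚ.* k₂ ℚ.* k₃ ≡ 0ℚ
  recurrence-from-ratios ν κ A B₁ B₂ C₁ C₂ C₃ ≡.refl ≡.refl ≡.refl ≡.refl ≡.refl ≡.refl rA rB₁ rC₁ rB₂ rC₂ =
    ≡.trans (certificate ν κ A B₁ B₂ C₁ C₂ C₃) (combination≡0 cA cB₁ cC₁ cB₂ cC₂ rA rB₁ rC₁ rB₂ rC₂)
    where
    n₁ n₂ n₃ k₁ k₂ k₃ : ℚ
    n₁ = 1ℚ ℚ.+ ν
    n₂ = 1ℚ ℚ.+ n₁
    n₃ = 1ℚ ℚ.+ n₂
    k₁ = 1ℚ ℚ.+ κ
    k₂ = 1ℚ ℚ.+ k₁
    k₃ = 1ℚ ℚ.+ k₂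
    cA cB₁ cC₁ cB₂ cC₂ : ℚ
    cA  = (n₃ ℚ.+ 1ℚ) ℚ.* k₁ ℚ.* k₂
    cB₁ = ℚ.- (n₂ ℚ.+ n₃) ℚ.* k₁ ℚ.* k₂
    cC₁ = n₁ ℚ.* k₁ ℚ.* k₂
    cB₂ = (n₃ ℚ.+ 1ℚ) ℚ.* n₃ ℚ.* n₂ ℚ.- (n₂ ℚ.+ n₃) ℚ.* ((n₂ ℚ.- k₁) ℚ.* (n₁ ℚ.- k₁) ℚ.+ k₂ ℚ.* k₃)
    cC₂ = n₁ ℚ.* (n₁ ℚ.- k₁) ℚ.* (ν ℚ.- k₁) ℚ.- (n₁ ℚ.+ n₁) ℚ.* k₂ ℚ.* k₃

  narayana-recurrence : ∀ N K →
    odeTerms (ι (3 ℕ.+ N) ℚ.* Nar (2 ℕ.+ N) (2 ℕ.+ K)) (ι (2 ℕ.+ N) ℚ.* Nar (1 ℕ.+ N) (2 ℕ.+ K)) (ι (2 ℕ.+ N) ℚ.* Nar (1 ℕ.+ N) (1 ℕ.+ K))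
             (ι (1 ℕ.+ N) ℚ.* Nar N (2 ℕ.+ K)) (ι (1 ℕ.+ N) ℚ.* Nar N (1 ℕ.+ K)) (ι (1 ℕ.+ N) ℚ.* Nar N K)
             (Nar (2 ℕ.+ N) (2 ℕ.+ K)) (Nar (1 ℕ.+ N) (2 ℕ.+ K)) (Nar (1 ℕ.+ N) (1 ℕ.+ K)) ≡ 0ℚ
  narayana-recurrence N K =
    *ι≡0⇒≡0 K (*ι≡0⇒≡0 (1 ℕ.+ K) (*ι≡0⇒≡0 (1 ℕ.+ K) (*ι≡0⇒≡0 (2 ℕ.+ K)
      (recurrence-from-ratios (ι N) (ι K) _ _ _ _ _ _
        (ι-suc N) (ι-suc (1 ℕ.+ N)) (ι-suc (2 ℕ.+ N)) (ι-suc K) (ι-suc (1 ℕ.+ K)) (ι-suc (2 ℕ.+ K))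
        (≡.trans (Nar-ratio-t (2 ℕ.+ N) (1 ℕ.+ K)) (Nar-ratio-q (1 ℕ.+ N) (1 ℕ.+ K)))
        (Nar-ratio-t (1 ℕ.+ N) (1 ℕ.+ K))
        (Nar-ratio-t N (1 ℕ.+ K))
        (≡.trans (Nar-ratio-t (1 ℕ.+ N) K) (Nar-ratio-q N K))
        (Nar-ratio-t N K)))))

  private
    combination₃≡0 : ∀ {x₁ y₁ x₂ y₂ x₃ y₃} c₁ c₂ c₃ → x₁ ≡ y₁ → x₂ ≡ y₂ → x₃ ≡ y₃ →
                     c₁ ℚ.* (x₁ ℚ.- y₁) ℚ.+ c₂ ℚ.* (x₂ ℚ.- y₂) ℚ.+ c₃ ℚ.* (x₃ ℚ.- y₃) ≡ 0ℚ
    combination₃≡0 {y₁ = y₁} {y₂ = y₂} {y₃ = y₃} c₁ c₂ c₃ ≡.refl ≡.refl ≡.refl = cancels c₁ c₂ c₃ y₁ y₂ y₃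
      where
      cancels : ∀ c₁ c₂ c₃ y₁ y₂ y₃ → c₁ ℚ.* (y₁ ℚ.- y₁) ℚ.+ c₂ ℚ.* (y₂ ℚ.- y₂) ℚ.+ c₃ ℚ.* (y₃ ℚ.- y₃) ≡ 0ℚ
      cancels = solve-∀ ℚ-ring

    certificate₁ : ∀ ν X₀ X₁ X₂ →
      let n₁ = 1ℚ ℚ.+ ν ; n₂ = 1ℚ ℚ.+ n₁ ; n₃ = 1ℚ ℚ.+ n₂ in
      (n₃ ℚ.* X₂ ℚ.- (n₂ ℚ.* X₁ ℚ.+ n₂ ℚ.* X₁) ℚ.- (n₂ ℚ.* 1ℚ ℚ.+ n₂ ℚ.* 1ℚ) ℚ.+ n₁ ℚ.* X₀
        ℚ.- (n₁ ℚ.* 1ℚ ℚ.+ n₁ ℚ.* 1ℚ) ℚ.+ 0ℚ ℚ.+ X₂ ℚ.- X₁ ℚ.- 1ℚ) ℚ.* ι 1 ℚ.* ι 2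
      ≡ (n₃ ℚ.+ 1ℚ) ℚ.* (ι 1 ℚ.* ι 2 ℚ.* X₂ ℚ.- (n₃ ℚ.- ι 0) ℚ.* (n₂ ℚ.- ι 0) ℚ.* 1ℚ)
        ℚ.+ ℚ.- (n₂ ℚ.+ n₂ ℚ.+ 1ℚ) ℚ.* (ι 1 ℚ.* ι 2 ℚ.* X₁ ℚ.- (n₂ ℚ.- ι 0) ℚ.* (n₁ ℚ.- ι 0) ℚ.* 1ℚ)
        ℚ.+ n₁ ℚ.* (ι 1 ℚ.* ι 2 ℚ.* X₀ ℚ.- (n₁ ℚ.- ι 0) ℚ.* (ν ℚ.- ι 0) ℚ.* 1ℚ)
    certificate₁ = solve-∀ ℚ-ring

    recurrence₀ : ∀ {n₁ n₂ n₃} ν → n₁ ≡ 1ℚ ℚ.+ ν → n₂ ≡ 1ℚ ℚ.+ n₁ → n₃ ≡ 1ℚ ℚ.+ n₂ →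
                  odeTerms (n₃ ℚ.* 1ℚ) (n₂ ℚ.* 1ℚ) 0ℚ (n₁ ℚ.* 1ℚ) 0ℚ 0ℚ 1ℚ 1ℚ 0ℚ ≡ 0ℚ
    recurrence₀ ν ≡.refl ≡.refl ≡.refl = identity ν
      where
      identity : ∀ ν → let n₁ = 1ℚ ℚ.+ ν ; n₂ = 1ℚ ℚ.+ n₁ ; n₃ = 1ℚ ℚ.+ n₂ in
        n₃ ℚ.* 1ℚ ℚ.- (n₂ ℚ.* 1ℚ ℚ.+ n₂ ℚ.* 1ℚ) ℚ.- (0ℚ ℚ.+ 0ℚ) ℚ.+ n₁ ℚ.* 1ℚ ℚ.- (0ℚ ℚ.+ 0ℚ) ℚ.+ 0ℚ
          ℚ.+ 1ℚ ℚ.- 1ℚ ℚ.- 0ℚ ≡ 0ℚ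
      identity = solve-∀ ℚ-ring

  recurrence₁-from-ratios : ∀ {n₁ n₂ n₃} ν X₀ X₁ X₂ → n₁ ≡ 1ℚ ℚ.+ ν → n₂ ≡ 1ℚ ℚ.+ n₁ → n₃ ≡ 1ℚ ℚ.+ n₂ →
    ι 1 ℚ.* ι 2 ℚ.* X₂ ≡ (n₃ ℚ.- ι 0) ℚ.* (n₂ ℚ.- ι 0) ℚ.* 1ℚ →
    ι 1 ℚ.* ι 2 ℚ.* X₁ ≡ (n₂ ℚ.- ι 0) ℚ.* (n₁ ℚ.- ι 0) ℚ.* 1ℚ →
    ι 1 ℚ.* ι 2 ℚ.* X₀ ≡ (n₁ ℚ.- ι 0) ℚ.* (ν ℚ.- ι 0) ℚ.* 1ℚ →
    odeTerms (n₃ ℚ.* X₂) (n₂ ℚ.* X₁) (n₂ ℚ.* 1ℚ) (n₁ ℚ.* X₀) (n₁ ℚ.* 1ℚ) 0ℚ X₂ X₁ 1ℚ ℚ.* ι 1 ℚ.* ι 2 ≡ 0ℚ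
  recurrence₁-from-ratios ν X₀ X₁ X₂ ≡.refl ≡.refl ≡.refl r₂ r₁ r₀ =
    ≡.trans (certificate₁ ν X₀ X₁ X₂) (combination₃≡0 (n₃ ℚ.+ 1ℚ) (ℚ.- (n₂ ℚ.+ n₂ ℚ.+ 1ℚ)) n₁ r₂ r₁ r₀)
    where
    n₁ n₂ n₃ : ℚ
    n₁ = 1ℚ ℚ.+ ν
    n₂ = 1ℚ ℚ.+ n₁
    n₃ = 1ℚ ℚ.+ n₂

  narayana-recurrence₀ : ∀ N →
    odeTerms (ι (3 ℕ.+ N) ℚ.* Nar (2 ℕ.+ N) 0) (ι (2 ℕ.+ N) ℚ.* Nar (1 ℕ.+ N) 0) 0ℚ (ι (1 ℕ.+ N) ℚ.* Nar N 0) 0ℚ 0ℚ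
             (Nar (2 ℕ.+ N) 0) (Nar (1 ℕ.+ N) 0) 0ℚ ≡ 0ℚ
  narayana-recurrence₀ N = recurrence₀ (ι N) (ι-suc N) (ι-suc (1 ℕ.+ N)) (ι-suc (2 ℕ.+ N))

  narayana-recurrence₁ : ∀ N →
    odeTerms (ι (3 ℕ.+ N) ℚ.* Nar (2 ℕ.+ N) 1) (ι (2 ℕ.+ N) ℚ.* Nar (1 ℕ.+ N) 1) (ι (2 ℕ.+ N) ℚ.* Nar (1 ℕ.+ N) 0)
             (ι (1 ℕ.+ N) ℚ.* Nar N 1) (ι (1 ℕ.+ N) ℚ.* Nar N 0) 0ℚ
             (Nar (2 ℕ.+ N) 1) (Nar (1 ℕ.+ N) 1) (Nar (1 ℕ.+ N) 0) ≡ 0ℚ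
  narayana-recurrence₁ N = *ι≡0⇒≡0 0 (*ι≡0⇒≡0 1
    (recurrence₁-from-ratios (ι N) _ _ _ (ι-suc N) (ι-suc (1 ℕ.+ N)) (ι-suc (2 ℕ.+ N))
      (Nar-ratio-t (2 ℕ.+ N) 0) (Nar-ratio-t (1 ℕ.+ N) 0) (Nar-ratio-t N 0)))


module NarayanaEquation where

  open import Defs using (PS; gamma; psOne; psSub)

  open Bivariate
  open Casts
  open NarayanaNumbers using (Nar; narayanaCoef-suc)
  open NarayanaRecurrence
  open import Relation.Binary.Reasoning.Setoid setoid

  G : PS
  G = psSub gamma psOne

  Ĝ : PS
  Ĝ zero    κ = 0ℚ
  Ĝ (suc x) κ = Nar x κ

  G≈Ĝ : G ≈ Ĝ
  G≈Ĝ zero    zero    = ≡.refl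
  G≈Ĝ zero    (suc κ) = ≡.refl
  G≈Ĝ (suc x) κ       = ≡.trans (ℚ.+-identityʳ _) (narayanaCoef-suc x κ)

  w : ℕ → T.Series
  w n = T.const (ι n)

  w-additive : ∀ n a → a ≤ n → w a T.+ₛ w (n ∸ a) T.≋ w n
  w-additive n a a≤n zero    = ≡.trans (≡.sym (ι-+ a (n ∸ a))) (≡.cong ι (ℕ.m+[n∸m]≡n a≤n))
  w-additive n a a≤n (suc k) = ≡.refl

  -- θ is q d/dq.
  module Θ = Q.Derivation w w-additive
  open Θ using (θ)

  θ′ : PS → PS
  θ′ f n k = ι n ℚ.* f n k

  θ≈θ′ : ∀ f → θ f ≈ θ′ f
  θ≈θ′ f n = T.const-*ₛ (ι n) (f n)

  -- Δ·Z + s·F for Δ = (1 − q − tq)² − 4tq² and s = 1 − q − tq, expanded;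
  -- mq and mt stand for multiplication by q and by t.
  odeForm : (PS → PS) → (PS → PS) → PS → PS → PS
  odeForm mq mt Z F = Z - (mq Z + mq Z) - (mt (mq Z) + mt (mq Z)) + mq (mq Z)
                        - (mt (mq (mq Z)) + mt (mq (mq Z))) + mt (mt (mq (mq Z))) + F - mq F - mt (mq F)

  odeForm-cong : ∀ {mq mq′ mt mt′ Z Z′ F F′} → (∀ f → mq f ≈ mq′ f) → (∀ f → mt f ≈ mt′ f) →
                 (∀ {f f′} → f ≈ f′ → mq′ f ≈ mq′ f′) → (∀ {f f′} → f ≈ f′ → mt′ f ≈ mt′ f′) →
                 Z ≈ Z′ → F ≈ F′ → odeForm mq mt Z F ≈ odeForm mq′ mt′ Z′ F′
  odeForm-cong {mq} {mq′} {mt} {mt′} mq≈ mt≈ mq′-cong mt′-cong Z≈ F≈ =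
    +-cong (+-cong (+-cong (+-cong (+-cong (+-cong (+-cong (+-cong Z≈
      (-‿cong (+-cong (Mq Z≈) (Mq Z≈)))) (-‿cong (+-cong (Mt (Mq Z≈)) (Mt (Mq Z≈))))) (Mq (Mq Z≈)))
      (-‿cong (+-cong (Mt (Mq (Mq Z≈))) (Mt (Mq (Mq Z≈)))))) (Mt (Mt (Mq (Mq Z≈))))) F≈)
      (-‿cong (Mq F≈))) (-‿cong (Mt (Mq F≈)))
    where
    Mq : ∀ {f f′} → f ≈ f′ → mq f ≈ mq′ f′
    Mq {f} f≈f′ = trans (mq≈ f) (mq′-cong f≈f′)
    Mt : ∀ {f f′} → f ≈ f′ → mt f ≈ mt′ f′
    Mt {f} f≈f′ = trans (mt≈ f) (mt′-cong f≈f′)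

  θ′-cong : ∀ {f f′} → f ≈ f′ → θ′ f ≈ θ′ f′
  θ′-cong f≈f′ n k = ≡.cong (ι n ℚ.*_) (f≈f′ n k)

  private
    odeForm-G≈Ĝ : odeForm shiftQ shiftT (θ′ G) G ≈ odeForm shiftQ shiftT (θ′ Ĝ) Ĝ
    odeForm-G≈Ĝ = odeForm-cong (λ _ → refl) (λ _ → refl) shiftQ-cong shiftT-cong (θ′-cong G≈Ĝ) G≈Ĝ

  ode-coefficients : odeForm shiftQ shiftT (θ′ G) G ≈ q + q
  ode-coefficients zero zero                                  = ≡.refl
  ode-coefficients zero (suc zero)                            = ≡.refl
  ode-coefficients zero (suc (suc k))                         = ≡.refl
  ode-coefficients (suc zero) zero                            = ≡.refl
  ode-coefficients (suc zero) (suc zero)                      = ≡.refl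
  ode-coefficients (suc zero) (suc (suc zero))                = ≡.refl
  ode-coefficients (suc zero) (suc (suc (suc k)))             = ≡.refl
  ode-coefficients (suc (suc zero)) zero                      = ≡.refl
  ode-coefficients (suc (suc zero)) (suc zero)                = ≡.refl
  ode-coefficients (suc (suc zero)) (suc (suc zero))          = ≡.refl
  ode-coefficients (suc (suc zero)) (suc (suc (suc zero)))    = ≡.refl
  ode-coefficients (suc (suc zero)) (suc (suc (suc (suc k)))) = ≡.refl
  ode-coefficients (suc (suc (suc N))) zero                   = ≡.trans (odeForm-G≈Ĝ (3 ℕ.+ N) 0) (narayana-recurrence₀ N)
  ode-coefficients (suc (suc (suc N))) (suc zero)             = ≡.trans (odeForm-G≈Ĝ (3 ℕ.+ N) 1) (narayana-recurrence₁ N)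
  ode-coefficients (suc (suc (suc N))) (suc (suc K))          = ≡.trans (odeForm-G≈Ĝ (3 ℕ.+ N) (2 ℕ.+ K)) (narayana-recurrence N K)

  w1≈1 : w 1 T.≋ T.1ₛ
  w1≈1 zero    = ≡.refl
  w1≈1 (suc k) = ≡.refl

  open ℚAlgebra.NarayanaDiscriminant ℚ[[t]][[q]] ιℚ θ Θ.θ-+ Θ.θ-neg Θ.θ-* (λ a → Θ.θ-const (T.const a))
         q t G (Θ.θ-X w1≈1) (Θ.θ-const T.X)
    using (s; Δ; D; E; D-ode; D≈4tqE; E-normal)

  narayana-ode : Δ * θ G + s * G ≈ two * q
  narayana-ode = begin
    Δ * θ G + s * G                 ≈⟨ expand q t (θ G) G ⟩
    odeForm (q *_) (t *_) (θ G) G   ≈⟨ odeForm-cong q*≈shiftQ t*≈shiftT shiftQ-cong shiftT-cong (θ≈θ′ G) refl ⟩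
    odeForm shiftQ shiftT (θ′ G) G  ≈⟨ ode-coefficients ⟩
    q + q                           ≈⟨ solve 1 (λ q → q :+ q := con (1ℚ ℚ.+ 1ℚ) :* q) refl q ⟩
    two * q                         ∎
    where
    expand : ∀ q t Z F → let s = 1# - q - t * q in
             (s * s - two * two * (t * q * q)) * Z + s * F ≈ odeForm (q *_) (t *_) Z F
    expand = solve 4 (λ q t Z F →
      let s = con 1ℚ :- q :- t :* q ; tw = con (1ℚ ℚ.+ 1ℚ) in
      (s :* s :- tw :* tw :* (t :* q :* q)) :* Z :+ s :* F
      := Z :- (q :* Z :+ q :* Z) :- (t :* (q :* Z) :+ t :* (q :* Z)) :+ q :* (q :* Z)
         :- (t :* (q :* (q :* Z)) :+ t :* (q :* (q :* Z))) :+ t :* (t :* (q :* (q :* Z))) :+ F :- q :* F :- t :* (q :* F)) refl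

  private
    module R₁ = CommutativeRing ℚ[[t]]
    open import Algebra.Properties.Ring R₁.ring using () renaming (-0#≈0# to -0≈0)

    four₀ : T.Series
    four₀ = (two * two) 0

    Δ-constant-term : Δ 0 R₁.≈ R₁.1#
    Δ-constant-term =
      R₁.trans (R₁.+-cong (R₁.*-cong s₀≈1 s₀≈1) (R₁.-‿cong (R₁.trans (R₁.*-congˡ {four₀} (R₁.zeroʳ ((t * q) 0))) (R₁.zeroʳ four₀))))
               (R₁.trans (R₁.+-cong (R₁.*-identityˡ R₁.1#) -0≈0) (R₁.+-identityʳ R₁.1#))
      where
      s₀≈1 : s 0 R₁.≈ R₁.1#
      s₀≈1 = R₁.trans (R₁.+-cong (R₁.+-congˡ {R₁.1#} -0≈0) (R₁.trans (R₁.-‿cong (R₁.zeroʳ T.X)) -0≈0))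
                      (R₁.trans (R₁.+-identityʳ (R₁.1# R₁.+ R₁.0#)) (R₁.+-identityʳ R₁.1#))

    D-constant-term : D 0 R₁.≈ R₁.0#
    D-constant-term = R₁.trans (D≈4tqE 0)
      (R₁.trans (R₁.*-congˡ {four₀} (R₁.trans (R₁.*-congˡ {T.X} (R₁.zeroˡ (E 0))) (R₁.zeroʳ T.X))) (R₁.zeroʳ four₀))

    w-cancel : ∀ n x → w (suc n) R₁.* x R₁.≈ R₁.0# → x R₁.≈ R₁.0#
    w-cancel n x wx≈0 k = *ι≡0⇒≡0 n (≡.trans (ℚ.*-comm (x k) (ι (suc n))) (≡.trans (≡.sym (T.const-*ₛ (ι (suc n)) x k)) (wx≈0 k)))

    scale : ∀ c f → Q.const (T.const c) * f ≈ (λ n k → c ℚ.* f n k)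
    scale c f n k = ≡.trans (Q.const-*ₛ (T.const c) f n k) (T.const-*ₛ c (f n) k)

    4tq-cancel : ∀ f → two * two * (t * (q * f)) ≈ 0# → f ≈ 0#
    4tq-cancel f 4tqf≈0 n k = *ι≡0⇒≡0 3 (≡.trans (ℚ.*-comm (f n k) (ι 4)) (≡.trans (≡.sym coefficient) (4tqf≈0 (suc n) (suc k))))
      where
      open ACR._-Raw-AlmostCommutative⟶_ ιℚ using (*-homo)
      coefficient : (two * two * (t * (q * f))) (suc n) (suc k) ≡ ι 4 ℚ.* f n k
      coefficient = ≡.trans (*-congʳ {t * (q * f)} (sym (*-homo (1ℚ ℚ.+ 1ℚ) (1ℚ ℚ.+ 1ℚ))) (suc n) (suc k))
                   (≡.trans (scale _ (t * (q * f)) (suc n) (suc k))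
                     (≡.cong (ι 4 ℚ.*_) (≡.trans (t*≈shiftT (q * f) (suc n) (suc k)) (q*≈shiftQ f (suc n) k))))

  narayana-equation : q - (1# - q - t * q) * G + t * q * (G * G) ≈ 0#
  narayana-equation = trans (sym E-normal) (4tq-cancel E (trans (sym D≈4tqE) D≈0))
    where
    D≈0 : D ≈ 0#
    D≈0 = Θ.vanishing-wronskian Δ D (D-ode narayana-ode) Δ-constant-term D-constant-term w-cancel


module RhoNumbers where

  open import Data.Nat using (_+_; _*_)
  open import Data.Nat.Tactic.RingSolver using (solve-∀)

  open ≡.≡-Reasoning

  -- ρ̂ b i j is the coefficient of t^i in ρ(M; t, d) for M − d = b and d − i = j (and M ≥ 1):
  -- c₀ b i = C(b − 1 + i, i) and c₁ b i = C(b − 1 + i, i − 1), reading C(−1, 0) as 1, so that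
  -- b·ρ̂ b i j = (b + i + j)·c₀ b i·c₀ b j.
  c₀ c₁ : ℕ → ℕ → ℕ
  c₀ zero    zero    = 1
  c₀ zero    (suc i) = 0
  c₀ (suc a) i       = (a + i) C i
  c₁ b zero    = 0
  c₁ b (suc i) = (b + i) C i

  ρ̂ : ℕ → ℕ → ℕ → ℕ
  ρ̂ b i j = c₀ b i * c₀ b j + c₁ b i * c₀ b j + c₀ b i * c₁ b j

  c₀-zero : ∀ b → c₀ b 0 ≡ 1
  c₀-zero zero    = ≡.refl
  c₀-zero (suc a) = ≡.refl

  private
    pascal : ∀ a i → (suc a + suc i) C suc i ≡ (a + suc i) C suc i + (suc a + i) C i
    pascal a i = begin
      (suc a + suc i) C suc i                  ≡⟨ ≡.cong (λ n → suc n C suc i) (ℕ.+-suc a i) ⟩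
      suc (suc (a + i)) C suc i                ≡⟨ nCk+nC[k+1]≡[n+1]C[k+1] (suc (a + i)) i ⟨
      suc (a + i) C i + suc (a + i) C suc i    ≡⟨ ℕ.+-comm (suc (a + i) C i) (suc (a + i) C suc i) ⟩
      suc (a + i) C suc i + suc (a + i) C i    ≡⟨ ≡.cong (λ n → n C suc i + suc (a + i) C i) (ℕ.+-suc a i) ⟨
      (a + suc i) C suc i + (suc a + i) C i    ∎

  c₀-pascal : ∀ b i → c₀ (suc b) (suc i) ≡ c₀ b (suc i) + c₀ (suc b) i
  c₀-pascal zero    i = ≡.trans (nCn≡1 (suc i)) (≡.sym (nCn≡1 i))
  c₀-pascal (suc a) i = pascal a i

  c₁-pascal : ∀ b i → c₁ (suc b) (suc i) ≡ c₁ b (suc i) + c₁ (suc b) i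
  c₁-pascal b zero    = ≡.refl
  c₁-pascal b (suc i) = pascal b i

  ρ̂-sym : ∀ b i j → ρ̂ b i j ≡ ρ̂ b j i
  ρ̂-sym b i j = swap (c₀ b i) (c₁ b i) (c₀ b j) (c₁ b j)
    where
    swap : ∀ x y u v → x * u + y * u + x * v ≡ u * x + v * x + u * y
    swap = solve-∀

  -- Each of the three products c c′ in ρ̂ satisfies the identity separately, by Pascal's rule in both factors.
  ρ̂-pascal : ∀ b i j → ρ̂ (suc b) (suc i) (suc j) + ρ̂ (suc b) i j
                      ≡ ρ̂ b (suc i) (suc j) + ρ̂ (suc b) (suc i) j + ρ̂ (suc b) i (suc j)
  ρ̂-pascal b i j = bilinear (c₀ b (suc i)) (c₀ (suc b) i) (c₁ b (suc i)) (c₁ (suc b) i) (c₀ b (suc j)) (c₀ (suc b) j) (c₁ b (suc j)) (c₁ (suc b) j)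
                   (c₀-pascal b i) (c₁-pascal b i) (c₀-pascal b j) (c₁-pascal b j)
    where
    bilinear : ∀ {X Y U V} x x′ y y′ u u′ v v′ → X ≡ x + x′ → Y ≡ y + y′ → U ≡ u + u′ → V ≡ v + v′ →
               (X * U + Y * U + X * V) + (x′ * u′ + y′ * u′ + x′ * v′)
               ≡ (x * u + y * u + x * v) + (X * u′ + Y * u′ + X * v′) + (x′ * U + y′ * U + x′ * V)
    bilinear x x′ y y′ u u′ v v′ ≡.refl ≡.refl ≡.refl ≡.refl = expand x x′ y y′ u u′ v v′
      where
      expand : ∀ x x′ y y′ u u′ v v′ →
               ((x + x′) * (u + u′) + (y + y′) * (u + u′) + (x + x′) * (v + v′)) + (x′ * u′ + y′ * u′ + x′ * v′)
               ≡ (x * u + y * u + x * v) + ((x + x′) * u′ + (y + y′) * u′ + (x + x′) * v′) + (x′ * (u + u′) + y′ * (u + u′) + x′ * (v + v′))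
      expand = solve-∀

  ρ̂-pascal-i0 : ∀ b i → ρ̂ (suc b) (suc i) 0 ≡ ρ̂ b (suc i) 0 + ρ̂ (suc b) i 0
  ρ̂-pascal-i0 b i rewrite c₀-zero b = edge (c₀ b (suc i)) (c₀ (suc b) i) (c₁ b (suc i)) (c₁ (suc b) i) (c₀-pascal b i) (c₁-pascal b i)
    where
    edge : ∀ {X Y} x x′ y y′ → X ≡ x + x′ → Y ≡ y + y′ →
           X * 1 + Y * 1 + X * 0 ≡ (x * 1 + y * 1 + x * 0) + (x′ * 1 + y′ * 1 + x′ * 0)
    edge x x′ y y′ ≡.refl ≡.refl = expand x x′ y y′
      where
      expand : ∀ x x′ y y′ → (x + x′) * 1 + (y + y′) * 1 + (x + x′) * 0 ≡ (x * 1 + y * 1 + x * 0) + (x′ * 1 + y′ * 1 + x′ * 0)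
      expand = solve-∀

  ρ̂-pascal-0j : ∀ b j → ρ̂ (suc b) 0 (suc j) ≡ ρ̂ b 0 (suc j) + ρ̂ (suc b) 0 j
  ρ̂-pascal-0j b j = begin
    ρ̂ (suc b) 0 (suc j)              ≡⟨ ρ̂-sym (suc b) 0 (suc j) ⟩
    ρ̂ (suc b) (suc j) 0              ≡⟨ ρ̂-pascal-i0 b j ⟩
    ρ̂ b (suc j) 0 + ρ̂ (suc b) j 0    ≡⟨ ≡.cong₂ _+_ (ρ̂-sym b (suc j) 0) (ρ̂-sym (suc b) j 0) ⟩
    ρ̂ b 0 (suc j) + ρ̂ (suc b) 0 j    ∎

  c₁-scaled : ∀ a i → suc a * c₁ (suc a) i ≡ i * c₀ (suc a) i
  c₁-scaled a zero    = ℕ.*-zeroʳ (suc a)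
  c₁-scaled a (suc i) = ℕ.+-cancelʳ-≡ (i * (n C i)) _ _ (begin
    suc a * ((suc a + i) C i) + i * (n C i) ≡⟨ ≡.cong (λ m → suc a * (m C i) + i * (n C i)) (ℕ.+-suc a i) ⟨
    suc a * (n C i) + i * (n C i)            ≡⟨ ℕ.*-distribʳ-+ (n C i) (suc a) i ⟨
    (suc a + i) * (n C i)                    ≡⟨ ≡.cong (_* (n C i)) (ℕ.+-suc a i) ⟨
    n * (n C i)                              ≡⟨ Binomial.absorption-lower n i ⟨
    suc i * (n C suc i) + i * (n C i)        ∎)
    where
    n : ℕ
    n = a + suc i

  ρ̂-scaled : ∀ a i j → suc a * ρ̂ (suc a) i j ≡ suc (a + (i + j)) * (c₀ (suc a) i * c₀ (suc a) j)
  ρ̂-scaled a i j = begin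
    suc a * (x * u + y * u + x * v)                ≡⟨ regroup (suc a) x y u v ⟩
    suc a * x * u + (suc a * y) * u + x * (suc a * v)  ≡⟨ ≡.cong₂ (λ p r → suc a * x * u + p * u + x * r) (c₁-scaled a i) (c₁-scaled a j) ⟩
    suc a * x * u + (i * x) * u + x * (j * u)      ≡⟨ collect a i j x u ⟩
    suc (a + (i + j)) * (x * u)                    ∎
    where
    x y u v : ℕ
    x = c₀ (suc a) i
    y = c₁ (suc a) i
    u = c₀ (suc a) j
    v = c₁ (suc a) j
    regroup : ∀ s x y u v → s * (x * u + y * u + x * v) ≡ s * x * u + (s * y) * u + x * (s * v)
    regroup = solve-∀
    collect : ∀ a i j x u → suc a * x * u + (i * x) * u + x * (j * u) ≡ suc (a + (i + j)) * (x * u)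
    collect = solve-∀


module RhoCoefficients where

  open Tactic.RingSolver using (solve-∀)
  open import Defs using (rhoCoef; frac)

  open Casts
  open RhoNumbers
  open ≡.≡-Reasoning

  δ : ℕ → ℕ → ℚ
  δ zero    zero    = 1ℚ
  δ zero    (suc _) = 0ℚ
  δ (suc _) zero    = 0ℚ
  δ (suc a) (suc b) = δ a b

  δ-refl : ∀ a → δ a a ≡ 1ℚ
  δ-refl zero    = ≡.refl
  δ-refl (suc a) = δ-refl a

  δ-≢ : ∀ {a b} → a ≢ b → δ a b ≡ 0ℚ
  δ-≢ {zero}  {zero}  a≢b = ⊥-elim (a≢b ≡.refl)
  δ-≢ {zero}  {suc b} a≢b = ≡.refl
  δ-≢ {suc a} {zero}  a≢b = ≡.refl
  δ-≢ {suc a} {suc b} a≢b = δ-≢ (λ a≡b → a≢b (≡.cong suc a≡b))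

  rhoCoef-diagonal : ∀ M i → rhoCoef M M i ≡ δ 0 i ℚ.+ δ M i
  rhoCoef-diagonal M zero with M ℕ.<? M
  ... | yes M<M = ⊥-elim (ℕ.<-irrefl ≡.refl M<M)
  ... | no _ with M ℕ.≟ M
  ...   | no M≢M = ⊥-elim (M≢M ≡.refl)
  ...   | yes _ with zero ℕ.≟ M
  ...     | yes ≡.refl = ≡.refl
  ...     | no  0≢M    = ≡.cong (1ℚ ℚ.+_) (≡.sym (δ-≢ (λ M≡0 → 0≢M (≡.sym M≡0))))
  rhoCoef-diagonal M (suc i) with M ℕ.<? M
  ... | yes M<M = ⊥-elim (ℕ.<-irrefl ≡.refl M<M)
  ... | no _ with M ℕ.≟ M
  ...   | no M≢M = ⊥-elim (M≢M ≡.refl)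
  ...   | yes _ with suc i ℕ.≟ M
  ...     | yes ≡.refl = ≡.cong (0ℚ ℚ.+_) (≡.sym (δ-refl (suc i)))
  ...     | no  i≢M    = ≡.cong (0ℚ ℚ.+_) (≡.sym (δ-≢ (λ M≡i → i≢M (≡.sym M≡i))))

  rhoCoef-above : ∀ M d i → d < i → rhoCoef M d i ≡ 0ℚ
  rhoCoef-above M d (suc i) d<i with d ℕ.<? M
  ... | yes _ with suc i ℕ.≤? d
  ...   | yes i<d = ⊥-elim (ℕ.<⇒≱ d<i i<d)
  ...   | no  _   = ≡.refl
  rhoCoef-above M d (suc i) d<i | no _ with d ℕ.≟ M
  ... | no  _      = ≡.refl
  ... | yes ≡.refl with suc i ℕ.≟ d
  ...   | yes ≡.refl = ⊥-elim (ℕ.<-irrefl ≡.refl d<i)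
  ...   | no  _      = ≡.refl

  rhoCoef-beyond : ∀ M d i → M < d → rhoCoef M d i ≡ 0ℚ
  rhoCoef-beyond M d i M<d with d ℕ.<? M
  ... | yes d<M = ⊥-elim (ℕ.<-asym d<M M<d)
  ... | no _ with d ℕ.≟ M
  ...   | yes ≡.refl = ⊥-elim (ℕ.<-irrefl ≡.refl M<d)
  ...   | no  _      = ≡.refl

  private
    interior-value : ∀ a i j → frac (+ suc (a ℕ.+ (i ℕ.+ j))) (suc a) ℚ.* ι (c₀ (suc a) i ℕ.* c₀ (suc a) j) ≡ ι (ρ̂ (suc a) i j)
    interior-value a i j = *-cancelʳ-ι a (begin
      (+ M ℚ./ suc a) ℚ.* ι cc ℚ.* ι (suc a)   ≡⟨ swap (+ M ℚ./ suc a) (ι cc) (ι (suc a)) ⟩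
      (+ M ℚ./ suc a) ℚ.* ι (suc a) ℚ.* ι cc   ≡⟨ ≡.cong (ℚ._* ι cc) (/-*-ι (+ M) a) ⟩
      ι M ℚ.* ι cc                             ≡⟨ ι-* M cc ⟨
      ι (M ℕ.* cc)                             ≡⟨ ≡.cong ι (ρ̂-scaled a i j) ⟨
      ι (suc a ℕ.* ρ̂ (suc a) i j)              ≡⟨ ≡.cong ι (ℕ.*-comm (suc a) (ρ̂ (suc a) i j)) ⟩
      ι (ρ̂ (suc a) i j ℕ.* suc a)              ≡⟨ ι-* (ρ̂ (suc a) i j) (suc a) ⟩
      ι (ρ̂ (suc a) i j) ℚ.* ι (suc a)          ∎)
      where
      M cc : ℕ
      M  = suc (a ℕ.+ (i ℕ.+ j))
      cc = c₀ (suc a) i ℕ.* c₀ (suc a) j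
      swap : ∀ x y z → x ℚ.* y ℚ.* z ≡ x ℚ.* z ℚ.* y
      swap = solve-∀ ℚ-ring

  interior≡ρ̂ : ∀ a i j → rhoCoef (suc (a ℕ.+ (i ℕ.+ j))) (i ℕ.+ j) i ≡ ι (ρ̂ (suc a) i j)
  interior≡ρ̂ a i j with (i ℕ.+ j) ℕ.<? suc (a ℕ.+ (i ℕ.+ j))
  ... | no  d≮M = ⊥-elim (d≮M (s≤s (ℕ.m≤n+m (i ℕ.+ j) a)))
  ... | yes _ with i ℕ.≤? i ℕ.+ j
  ...   | no  i≰d = ⊥-elim (i≰d (ℕ.m≤m+n i j))
  ...   | yes _ = ≡.trans (≡.cong₂ (λ n c → frac (+ suc (a ℕ.+ (i ℕ.+ j))) n ℚ.* ι c) M-d≡1+a binomials) (interior-value a i j)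
    where
    M-d≡1+a : suc (a ℕ.+ (i ℕ.+ j)) ∸ (i ℕ.+ j) ≡ suc a
    M-d≡1+a = ℕ.m+n∸n≡m (suc a) (i ℕ.+ j)
    a+[i+j]∸i≡a+j : a ℕ.+ (i ℕ.+ j) ∸ i ≡ a ℕ.+ j
    a+[i+j]∸i≡a+j = ≡.trans (≡.cong (_∸ i) (≡.trans (≡.cong (a ℕ.+_) (ℕ.+-comm i j)) (≡.sym (ℕ.+-assoc a j i))))
                            (ℕ.m+n∸n≡m (a ℕ.+ j) i)
    binomials : ((a ℕ.+ (i ℕ.+ j) ∸ (i ℕ.+ j) ℕ.+ i) C i) ℕ.* ((a ℕ.+ (i ℕ.+ j) ∸ i) C (i ℕ.+ j ∸ i)) ≡ c₀ (suc a) i ℕ.* c₀ (suc a) j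
    binomials = ≡.cong₂ ℕ._*_ (≡.cong (λ n → (n ℕ.+ i) C i) (ℕ.m+n∸n≡m a (i ℕ.+ j)))
                              (≡.cong₂ _C_ a+[i+j]∸i≡a+j (ℕ.m+n∸m≡n i j))

  private
    ρ̂-top-left : ∀ M → ρ̂ 0 0 (suc M) ≡ 1
    ρ̂-top-left M = ≡.cong (λ c → 1 ℕ.* 0 ℕ.+ 0 ℕ.* 0 ℕ.+ 1 ℕ.* c) (nCn≡1 M)

    ρ̂-top-right : ∀ i → ρ̂ 0 (suc i) 0 ≡ 1
    ρ̂-top-right i = ≡.cong (λ c → 0 ℕ.* 1 ℕ.+ c ℕ.* 1 ℕ.+ 0 ℕ.* 0) (nCn≡1 i)

    ρ̂-top-inner : ∀ i j → ρ̂ 0 (suc i) (suc j) ≡ 0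
    ρ̂-top-inner i j = ≡.cong₂ (λ c c′ → 0 ℕ.* 0 ℕ.+ c ℕ.* 0 ℕ.+ 0 ℕ.* c′) (nCn≡1 i) (nCn≡1 j)

  diagonal≡ρ̂ : ∀ M i j → suc M ≡ i ℕ.+ j → rhoCoef (suc M) (suc M) i ≡ ι (ρ̂ 0 i j)
  diagonal≡ρ̂ M zero    j       ≡.refl = ≡.trans (rhoCoef-diagonal (suc M) 0) (≡.sym (≡.cong ι (ρ̂-top-left M)))
  diagonal≡ρ̂ M (suc i) zero    e = begin
    rhoCoef (suc M) (suc M) (suc i)  ≡⟨ rhoCoef-diagonal (suc M) (suc i) ⟩
    0ℚ ℚ.+ δ M i                     ≡⟨ ≡.cong (0ℚ ℚ.+_) (δ-refl′ (≡.trans (ℕ.suc-injective e) (ℕ.+-identityʳ i))) ⟩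
    0ℚ ℚ.+ 1ℚ                        ≡⟨ ≡.cong ι (ρ̂-top-right i) ⟨
    ι (ρ̂ 0 (suc i) 0)                ∎
    where
    δ-refl′ : ∀ {a b} → a ≡ b → δ a b ≡ 1ℚ
    δ-refl′ {a} ≡.refl = δ-refl a
  diagonal≡ρ̂ M (suc i) (suc j) e = begin
    rhoCoef (suc M) (suc M) (suc i)  ≡⟨ rhoCoef-diagonal (suc M) (suc i) ⟩
    0ℚ ℚ.+ δ M i                     ≡⟨ ≡.cong (0ℚ ℚ.+_) (δ-≢ M≢i) ⟩
    0ℚ ℚ.+ 0ℚ                        ≡⟨ ≡.cong ι (ρ̂-top-inner i j) ⟨
    ι (ρ̂ 0 (suc i) (suc j))          ∎
    where
    M≢i : M ≢ i
    M≢i M≡i = ℕ.m≢1+m+n i (≡.trans (≡.sym M≡i) (≡.trans (ℕ.suc-injective e) (ℕ.+-suc i j)))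

  rhoCoef≡ρ̂ : ∀ {M d} b i j → suc M ≡ b ℕ.+ d → d ≡ i ℕ.+ j → rhoCoef (suc M) d i ≡ ι (ρ̂ b i j)
  rhoCoef≡ρ̂ (suc a) i j e ≡.refl with ℕ.suc-injective e
  ... | ≡.refl = interior≡ρ̂ a i j
  rhoCoef≡ρ̂ zero i j ≡.refl e = diagonal≡ρ̂ _ i j e


module RhoRecurrence where

  open Tactic.RingSolver using (solve-∀)
  open import Defs using (PS; rhoCoef)

  open Bivariate
  open Casts
  open RhoNumbers
  open RhoCoefficients

  ρ : ℕ → PS
  ρ m d i = rhoCoef m d i

  RecurrenceAt : ℕ → ℕ → ℕ → Set
  RecurrenceAt m d i =
    ρ (suc (suc m)) d i ≡ (ρ (suc m) + shiftQ (ρ (suc m)) + shiftT (shiftQ (ρ (suc m))) - shiftT (shiftQ (shiftQ (ρ m)))) d i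

  private
    from-values : ∀ {x a b c e x′ a′ b′ c′ e′} → x ≡ x′ → a ≡ a′ → b ≡ b′ → c ≡ c′ → e ≡ e′ →
                  x′ ≡ a′ ℚ.+ b′ ℚ.+ c′ ℚ.- e′ → x ≡ a ℚ.+ b ℚ.+ c ℚ.- e
    from-values ≡.refl ≡.refl ≡.refl ≡.refl ≡.refl eq = eq

    ι-pascal : ∀ p₂ p₁ p₁′ p₁″ p₀ → p₂ ℕ.+ p₀ ≡ p₁ ℕ.+ p₁′ ℕ.+ p₁″ → ι p₂ ≡ ι p₁ ℚ.+ ι p₁′ ℚ.+ ι p₁″ ℚ.- ι p₀
    ι-pascal p₂ p₁ p₁′ p₁″ p₀ eq = begin
      ι p₂                                 ≡⟨ add-sub (ι p₂) (ι p₀) ⟩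
      (ι p₂ ℚ.+ ι p₀) ℚ.- ι p₀             ≡⟨ ≡.cong (ℚ._- ι p₀) (ι-+ p₂ p₀) ⟨
      ι (p₂ ℕ.+ p₀) ℚ.- ι p₀               ≡⟨ ≡.cong (λ n → ι n ℚ.- ι p₀) eq ⟩
      ι (p₁ ℕ.+ p₁′ ℕ.+ p₁″) ℚ.- ι p₀
        ≡⟨ ≡.cong (ℚ._- ι p₀) (≡.trans (ι-+ (p₁ ℕ.+ p₁′) p₁″) (≡.cong (ℚ._+ ι p₁″) (ι-+ p₁ p₁′))) ⟩
      ι p₁ ℚ.+ ι p₁′ ℚ.+ ι p₁″ ℚ.- ι p₀    ∎
      where
      open ≡.≡-Reasoning
      add-sub : ∀ x y → x ≡ (x ℚ.+ y) ℚ.- y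
      add-sub = solve-∀ ℚ-ring

    shiftQ-above : ∀ M d i → d ≤ i → shiftQ (ρ M) d i ≡ 0ℚ
    shiftQ-above M zero    i _   = ≡.refl
    shiftQ-above M (suc d) i d<i = rhoCoef-above M d i d<i

    shiftQ-beyond : ∀ M d i → suc M < d → shiftQ (ρ M) d i ≡ 0ℚ
    shiftQ-beyond M (suc d) i (s≤s M<d) = rhoCoef-beyond M d i M<d

  recurrence-above : ∀ m d i → d < i → RecurrenceAt m d i
  recurrence-above m d (suc i) d<i =
    from-values (rhoCoef-above (suc (suc m)) d (suc i) d<i) (rhoCoef-above (suc m) d (suc i) d<i)
                (shiftQ-above (suc m) d (suc i) (ℕ.<⇒≤ d<i)) (shiftQ-above (suc m) d i (ℕ.≤-pred d<i))
                (shiftQQ-above d (ℕ.≤-pred d<i)) ≡.refl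
    where
    shiftQQ-above : ∀ d → d ≤ i → shiftQ (shiftQ (ρ m)) d i ≡ 0ℚ
    shiftQQ-above zero    _   = ≡.refl
    shiftQQ-above (suc d) d<i = shiftQ-above m d i (ℕ.<⇒≤ d<i)

  recurrence-beyond : ∀ m d i → suc (suc m) < d → RecurrenceAt m d i
  recurrence-beyond m (suc (suc d)) i (s≤s (s≤s m<d)) =
    from-values (rhoCoef-beyond (suc (suc m)) (suc (suc d)) i (s≤s (s≤s m<d)))
                (rhoCoef-beyond (suc m) (suc (suc d)) i (s≤s (ℕ.m<n⇒m<1+n m<d)))
                (shiftQ-beyond (suc m) (suc (suc d)) i (s≤s (s≤s m<d))) (shiftT-term i) (shiftTQ-term i) ≡.refl
    where
    shiftT-term : ∀ i → shiftT (shiftQ (ρ (suc m))) (suc (suc d)) i ≡ 0ℚ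
    shiftT-term zero    = ≡.refl
    shiftT-term (suc i) = shiftQ-beyond (suc m) (suc (suc d)) i (s≤s (s≤s m<d))
    shiftTQ-term : ∀ i → shiftT (shiftQ (shiftQ (ρ m))) (suc (suc d)) i ≡ 0ℚ
    shiftTQ-term zero    = ≡.refl
    shiftTQ-term (suc i) = shiftQ-beyond m (suc d) i (s≤s m<d)

  recurrence-diagonal : ∀ m i → RecurrenceAt m (suc (suc m)) i
  recurrence-diagonal m zero =
    from-values {c = 0ℚ} {e = 0ℚ} (rhoCoef-diagonal (suc (suc m)) 0) (rhoCoef-beyond (suc m) (suc (suc m)) 0 ℕ.≤-refl)
                (rhoCoef-diagonal (suc m) 0) ≡.refl ≡.refl ≡.refl
  recurrence-diagonal m (suc i) =
    from-values (rhoCoef-diagonal (suc (suc m)) (suc i)) (rhoCoef-beyond (suc m) (suc (suc m)) (suc i) ℕ.≤-refl)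
                (rhoCoef-diagonal (suc m) (suc i)) (rhoCoef-diagonal (suc m) i) (rhoCoef-diagonal m i) (indicators (δ 0 i) (δ m i) (δ (suc m) i))
    where
    indicators : ∀ z x y → 0ℚ ℚ.+ y ≡ 0ℚ ℚ.+ (0ℚ ℚ.+ x) ℚ.+ (z ℚ.+ y) ℚ.- (z ℚ.+ x)
    indicators = solve-∀ ℚ-ring

  private
    ρ̂-origin : ∀ b → ρ̂ b 0 0 ≡ 1
    ρ̂-origin b rewrite c₀-zero b = ≡.refl

    pad-left : ∀ p₂ p₁ p₁′ → p₂ ≡ p₁ ℕ.+ p₁′ → p₂ ℕ.+ 0 ≡ p₁ ℕ.+ p₁′ ℕ.+ 0
    pad-left p₂ p₁ p₁′ eq = ≡.trans (ℕ.+-identityʳ p₂) (≡.trans eq (≡.sym (ℕ.+-identityʳ (p₁ ℕ.+ p₁′))))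

    pad-middle : ∀ p₂ p₁ p₁″ → p₂ ≡ p₁ ℕ.+ p₁″ → p₂ ℕ.+ 0 ≡ p₁ ℕ.+ 0 ℕ.+ p₁″
    pad-middle p₂ p₁ p₁″ eq = ≡.trans (ℕ.+-identityʳ p₂) (≡.trans eq (≡.cong (ℕ._+ p₁″) (≡.sym (ℕ.+-identityʳ p₁))))

  recurrence-pascal : ∀ b m d i j → suc m ≡ b ℕ.+ d → d ≡ i ℕ.+ j → RecurrenceAt m d i
  recurrence-pascal b m .0 zero zero e ≡.refl =
    from-values {b = 0ℚ} {c = 0ℚ} {e = 0ℚ} (rhoCoef≡ρ̂ (suc b) 0 0 (≡.cong suc e) ≡.refl) (rhoCoef≡ρ̂ b 0 0 e ≡.refl) ≡.refl ≡.refl ≡.refl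
                (ι-pascal (ρ̂ (suc b) 0 0) (ρ̂ b 0 0) 0 0 0
                  (≡.trans (≡.cong (ℕ._+ 0) (ρ̂-origin (suc b))) (≡.sym (≡.cong (λ x → x ℕ.+ 0 ℕ.+ 0) (ρ̂-origin b)))))
  recurrence-pascal b m .(suc j) zero (suc j) e ≡.refl =
    from-values {c = 0ℚ} {e = 0ℚ} (rhoCoef≡ρ̂ (suc b) 0 (suc j) (≡.cong suc e) ≡.refl) (rhoCoef≡ρ̂ b 0 (suc j) e ≡.refl)
                (rhoCoef≡ρ̂ (suc b) 0 j (≡.trans e (ℕ.+-suc b j)) ≡.refl) ≡.refl ≡.refl
                (ι-pascal (ρ̂ (suc b) 0 (suc j)) (ρ̂ b 0 (suc j)) (ρ̂ (suc b) 0 j) 0 0 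
                  (pad-left (ρ̂ (suc b) 0 (suc j)) (ρ̂ b 0 (suc j)) (ρ̂ (suc b) 0 j) (ρ̂-pascal-0j b j)))
  recurrence-pascal b m d (suc i) zero e d≡i+0 with ≡.trans d≡i+0 (ℕ.+-identityʳ (suc i))
  ... | ≡.refl =
    from-values (rhoCoef≡ρ̂ (suc b) (suc i) 0 (≡.cong suc e) d≡i+0) (rhoCoef≡ρ̂ b (suc i) 0 e d≡i+0)
                (rhoCoef-above (suc m) i (suc i) ℕ.≤-refl) (rhoCoef≡ρ̂ (suc b) i 0 (≡.trans e (ℕ.+-suc b i)) (≡.sym (ℕ.+-identityʳ i)))
                (shiftQ-above m i i ℕ.≤-refl)
                (ι-pascal (ρ̂ (suc b) (suc i) 0) (ρ̂ b (suc i) 0) 0 (ρ̂ (suc b) i 0) 0 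
                  (pad-middle (ρ̂ (suc b) (suc i) 0) (ρ̂ b (suc i) 0) (ρ̂ (suc b) i 0) (ρ̂-pascal-i0 b i)))
  recurrence-pascal b zero .(suc i ℕ.+ suc j) (suc i) (suc j) e ≡.refl
    with ≡.trans (ℕ.suc-injective (≡.trans e (ℕ.+-suc b (i ℕ.+ suc j)))) (≡.trans (≡.cong (b ℕ.+_) (ℕ.+-suc i j)) (ℕ.+-suc b (i ℕ.+ j)))
  ... | ()
  recurrence-pascal b (suc m) d (suc i) (suc j) e d≡i+j with ≡.trans d≡i+j (ℕ.+-suc (suc i) j)
  ... | ≡.refl =
    from-values (rhoCoef≡ρ̂ (suc b) (suc i) (suc j) (≡.cong suc e) d≡i+j) (rhoCoef≡ρ̂ b (suc i) (suc j) e d≡i+j)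
                (rhoCoef≡ρ̂ (suc b) (suc i) j (≡.trans e (ℕ.+-suc b (suc (i ℕ.+ j)))) ≡.refl)
                (rhoCoef≡ρ̂ (suc b) i (suc j) (≡.trans e (ℕ.+-suc b (suc (i ℕ.+ j)))) (≡.sym (ℕ.+-suc i j)))
                (rhoCoef≡ρ̂ (suc b) i j (ℕ.suc-injective (≡.trans e (≡.trans (ℕ.+-suc b (suc (i ℕ.+ j))) (≡.cong suc (ℕ.+-suc b (i ℕ.+ j)))))) ≡.refl)
                (ι-pascal (ρ̂ (suc b) (suc i) (suc j)) (ρ̂ b (suc i) (suc j)) (ρ̂ (suc b) (suc i) j) (ρ̂ (suc b) i (suc j)) (ρ̂ (suc b) i j)
                  (ρ̂-pascal b i j))

  ρ-recurrence : ∀ m → ρ (suc (suc m)) ≈ ρ (suc m) + shiftQ (ρ (suc m)) + shiftT (shiftQ (ρ (suc m))) - shiftT (shiftQ (shiftQ (ρ m)))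
  ρ-recurrence m d i with i ℕ.≤? d
  ... | no  i≰d = recurrence-above m d i (ℕ.≰⇒> i≰d)
  ... | yes i≤d with ℕ.<-cmp d (suc (suc m))
  ...   | tri< d<m+2 _ _   = recurrence-pascal (suc m ∸ d) m d i (d ∸ i)
                               (≡.sym (ℕ.m∸n+n≡m (ℕ.≤-pred d<m+2)))
                               (≡.sym (ℕ.m+[n∸m]≡n i≤d))
  ...   | tri≈ _ ≡.refl _ = recurrence-diagonal m i
  ...   | tri> _ _ m+2<d   = recurrence-beyond m d i m+2<d

module BetaRecurrence where

  open import Defs using (PS; beta; sgn)

  open Bivariate
  open RhoCoefficients using (rhoCoef-beyond)
  open RhoRecurrence using (ρ; ρ-recurrence)

  alternate : PS → PS
  alternate f d i = sgn d ℚ.* f d i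

  alternate-cong : ∀ {f g} → f ≈ g → alternate f ≈ alternate g
  alternate-cong f≈g d i = ≡.cong (sgn d ℚ.*_) (f≈g d i)

  alternate-+ : ∀ f g → alternate (f + g) ≈ alternate f + alternate g
  alternate-+ f g d i = ℚ.*-distribˡ-+ (sgn d) (f d i) (g d i)

  alternate-neg : ∀ f → alternate (- f) ≈ - alternate f
  alternate-neg f d i = ≡.sym (ℚ.neg-distribʳ-* (sgn d) (f d i))

  alternate-shiftQ : ∀ f → alternate (shiftQ f) ≈ - shiftQ (alternate f)
  alternate-shiftQ f zero    i = ≡.refl
  alternate-shiftQ f (suc d) i = ≡.sym (ℚ.neg-distribˡ-* (sgn d) (f d i))

  alternate-shiftT : ∀ f → alternate (shiftT f) ≈ shiftT (alternate f)
  alternate-shiftT f d zero    = ℚ.*-zeroʳ (sgn d)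
  alternate-shiftT f d (suc i) = ≡.refl

  shiftQ-neg : ∀ f → shiftQ (- f) ≈ - shiftQ f
  shiftQ-neg f zero    i = ≡.refl
  shiftQ-neg f (suc d) i = ≡.refl

  shiftT-neg : ∀ f → shiftT (- f) ≈ - shiftT f
  shiftT-neg f d zero    = ≡.refl
  shiftT-neg f d (suc i) = ≡.refl

  private
    open import Relation.Binary.Reasoning.Setoid setoid
    open import Algebra.Properties.Group +-group using (⁻¹-involutive)

    shift-form : ∀ f g → f - shiftQ f - shiftT (shiftQ f) - shiftT (shiftQ (shiftQ g)) ≈ (1# - q - t * q) * f - t * q * q * g
    shift-form f g = sym (begin
      (1# - q - t * q) * f - t * q * q * g                            ≈⟨ expand f g ⟩
      f - q * f - t * (q * f) - t * (q * (q * g))                     ≈⟨ +-cong (+-cong (+-congˡ {f} (-‿cong (q*≈shiftQ f))) (-‿cong tq)) (-‿cong tqq) ⟩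
      f - shiftQ f - shiftT (shiftQ f) - shiftT (shiftQ (shiftQ g))   ∎)
      where
      tq : t * (q * f) ≈ shiftT (shiftQ f)
      tq = trans (t*≈shiftT (q * f)) (shiftT-cong (q*≈shiftQ f))
      tqq : t * (q * (q * g)) ≈ shiftT (shiftQ (shiftQ g))
      tqq = trans (t*≈shiftT (q * (q * g))) (shiftT-cong (trans (q*≈shiftQ (q * g)) (shiftQ-cong (q*≈shiftQ g))))
      expand : ∀ f g → (1# - q - t * q) * f - t * q * q * g ≈ f - q * f - t * (q * f) - t * (q * (q * g))
      expand = solve 4 (λ q t f g → (con 1ℚ :- q :- t :* q) :* f :- t :* q :* q :* g := f :- q :* f :- t :* (q :* f) :- t :* (q :* (q :* g))) refl q t

  β-recurrence : ∀ m → beta (suc (suc m)) ≈ (1# - q - t * q) * beta (suc m) - t * q * q * beta m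
  β-recurrence m = begin
    alternate (ρ (suc (suc m)))
      ≈⟨ alternate-cong (ρ-recurrence m) ⟩
    alternate (ρ₁ + qρ₁ + tqρ₁ - tqqρ₀)
      ≈⟨ distribute ⟩
    alternate ρ₁ + alternate qρ₁ + alternate tqρ₁ - alternate tqqρ₀
      ≈⟨ +-cong (+-cong (+-congˡ {β₁} (alternate-shiftQ ρ₁)) third) (-‿cong fourth) ⟩
    β₁ - shiftQ β₁ - shiftT (shiftQ β₁) - shiftT (shiftQ (shiftQ β₀))
      ≈⟨ shift-form β₁ β₀ ⟩
    (1# - q - t * q) * β₁ - t * q * q * β₀ ∎
    where
    ρ₁ ρ₀ β₁ β₀ qρ₁ tqρ₁ tqqρ₀ : PS
    ρ₁    = ρ (suc m)
    ρ₀    = ρ m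
    β₁    = beta (suc m)
    β₀    = beta m
    qρ₁   = shiftQ ρ₁
    tqρ₁  = shiftT (shiftQ ρ₁)
    tqqρ₀ = shiftT (shiftQ (shiftQ ρ₀))
    distribute : alternate (ρ₁ + qρ₁ + tqρ₁ - tqqρ₀) ≈ alternate ρ₁ + alternate qρ₁ + alternate tqρ₁ - alternate tqqρ₀
    distribute = trans (alternate-+ (ρ₁ + qρ₁ + tqρ₁) (- tqqρ₀))
                       (+-cong (trans (alternate-+ (ρ₁ + qρ₁) tqρ₁) (+-congʳ {alternate tqρ₁} (alternate-+ ρ₁ qρ₁))) (alternate-neg tqqρ₀))
    third : alternate tqρ₁ ≈ - shiftT (shiftQ β₁)
    third = trans (alternate-shiftT (shiftQ ρ₁)) (trans (shiftT-cong (alternate-shiftQ ρ₁)) (shiftT-neg (shiftQ β₁)))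
    fourth : alternate tqqρ₀ ≈ shiftT (shiftQ (shiftQ β₀))
    fourth = trans (alternate-shiftT (shiftQ (shiftQ ρ₀))) (shiftT-cong (trans (alternate-shiftQ (shiftQ ρ₀))
               (trans (-‿cong (trans (shiftQ-cong (alternate-shiftQ ρ₀)) (shiftQ-neg (shiftQ β₀)))) (⁻¹-involutive (shiftQ (shiftQ β₀))))))

  β₀≈2 : beta 0 ≈ 1# + 1#
  β₀≈2 zero    zero    = ≡.refl
  β₀≈2 zero    (suc i) = ≡.refl
  β₀≈2 (suc d) i       = ≡.trans (≡.cong (sgn (suc d) ℚ.*_) (rhoCoef-beyond 0 (suc d) i (s≤s z≤n))) (ℚ.*-zeroʳ (sgn (suc d)))

  β₁≈s : beta 1 ≈ 1# - q - t * q
  β₁≈s = trans coefficients (+-congˡ {1# - q} (-‿cong (sym (t*≈shiftT q))))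
    where
    coefficients : beta 1 ≈ 1# - q - shiftT q
    coefficients zero          zero          = ≡.refl
    coefficients zero          (suc i)       = ≡.refl
    coefficients (suc zero)    zero          = ≡.refl
    coefficients (suc zero)    (suc zero)    = ≡.refl
    coefficients (suc zero)    (suc (suc i)) = ≡.refl
    coefficients (suc (suc d)) zero          = ℚ.*-zeroʳ (sgn (suc (suc d)))
    coefficients (suc (suc d)) (suc i)       = ℚ.*-zeroʳ (sgn (suc (suc d)))


module LaurentCoefficients where

  open import Data.Integer.Tactic.RingSolver using (solve-∀)
  open import Defs using (PS; laurent; shift; ser; lcoef; lAdd; lNeg; lZero)

  open Bivariate
  open ≡.≡-Reasoning

  coeff : ℤ → PS → ℕ → ℚ
  coeff (+ j)    f k = f j k
  coeff -[1+ _ ] f k = 0ℚ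

  lcoef≡coeff : ∀ L e k → lcoef L e k ≡ coeff (e ℤ.- shift L) (ser L) k
  lcoef≡coeff L e k with e ℤ.- shift L
  ... | + j      = ≡.refl
  ... | -[1+ j ] = ≡.refl

  coeff-cong : ∀ {f g} → f ≈ g → ∀ x k → coeff x f k ≡ coeff x g k
  coeff-cong f≈g (+ j)    k = f≈g j k
  coeff-cong f≈g -[1+ j ] k = ≡.refl

  coeff-+ : ∀ f g x k → coeff x (f + g) k ≡ coeff x f k ℚ.+ coeff x g k
  coeff-+ f g (+ j)    k = ≡.refl
  coeff-+ f g -[1+ j ] k = ≡.refl

  lcoef-laurent-cong : ∀ {s s′ f g} → s ≡ s′ → f ≈ g → ∀ e k → lcoef (laurent s f) e k ≡ lcoef (laurent s′ g) e k
  lcoef-laurent-cong {s} {_} {f} {g} ≡.refl f≈g e k = begin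
    lcoef (laurent s f) e k      ≡⟨ lcoef≡coeff (laurent s f) e k ⟩
    coeff (e ℤ.- s) f k          ≡⟨ coeff-cong f≈g (e ℤ.- s) k ⟩
    coeff (e ℤ.- s) g k          ≡⟨ lcoef≡coeff (laurent s g) e k ⟨
    lcoef (laurent s g) e k      ∎

  lcoef-lNeg : ∀ L e k → lcoef (lNeg L) e k ≡ ℚ.- lcoef L e k
  lcoef-lNeg L e k = ≡.trans (lcoef≡coeff (lNeg L) e k) (≡.trans (negate (e ℤ.- shift L)) (≡.cong ℚ.-_ (≡.sym (lcoef≡coeff L e k))))
    where
    negate : ∀ x → coeff x (λ n k → ℚ.- ser L n k) k ≡ ℚ.- coeff x (ser L) k
    negate (+ j)    = ≡.refl
    negate -[1+ j ] = ≡.refl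

  lcoef-lAdd : ∀ L M e k → lcoef (lAdd L M) e k ≡ lcoef L e k ℚ.+ lcoef M e k
  lcoef-lAdd L M e k = ≡.trans (lcoef≡coeff (lAdd L M) e k) (by-sign (e ℤ.- s) ≡.refl)
    where
    s : ℤ
    s = shift L ℤ.⊓ shift M
    below-shift : ∀ N j → s ℤ.≤ shift N → e ℤ.- s ≡ -[1+ j ] → lcoef N e k ≡ 0ℚ
    below-shift N j s≤N e-s≡- = ≡.trans (lcoef≡coeff N e k) (≡.cong (λ x → coeff x (ser N) k)
      (≡.trans (regroup e s (shift N)) (≡.trans (≡.cong₂ ℤ._-_ e-s≡- (≡.sym (ℤ.∣-∣-≤ s≤N))) (ℤ.neg-minus-pos j ℤ.∣ s ℤ.- shift N ∣))))
      where
      regroup : ∀ e s n → e ℤ.- n ≡ (e ℤ.- s) ℤ.- (n ℤ.- s)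
      regroup = solve-∀
    by-sign : ∀ x → e ℤ.- s ≡ x → coeff x (ser (lAdd L M)) k ≡ lcoef L e k ℚ.+ lcoef M e k
    by-sign (+ j)    e-s≡j = ≡.cong (λ z → lcoef L z k ℚ.+ lcoef M z k) (≡.trans (≡.cong (λ z → s ℤ.+ z) (≡.sym e-s≡j)) (cancel e s))
      where
      cancel : ∀ e s → s ℤ.+ (e ℤ.- s) ≡ e
      cancel = solve-∀
    by-sign -[1+ j ] e-s≡- = ≡.sym (≡.cong₂ ℚ._+_ (below-shift L j (ℤ.i⊓j≤i _ _) e-s≡-) (below-shift M j (ℤ.i⊓j≤j _ _) e-s≡-))

  q^*-≤ : ∀ n f j k → n ≤ j → (q ^ n * f) j k ≡ f (j ∸ n) k
  q^*-≤ zero    f j       k z≤n       = *-identityˡ f j k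
  q^*-≤ (suc n) f (suc j) k (s≤s n≤j) =
    ≡.trans (*-assoc q (q ^ n) f (suc j) k) (≡.trans (q*≈shiftQ (q ^ n * f) (suc j) k) (q^*-≤ n f j k n≤j))

  q^*-< : ∀ n f j k → j < n → (q ^ n * f) j k ≡ 0ℚ
  q^*-< (suc n) f zero    k _         = ≡.trans (*-assoc q (q ^ n) f zero k) (q*≈shiftQ (q ^ n * f) zero k)
  q^*-< (suc n) f (suc j) k (s≤s j<n) =
    ≡.trans (*-assoc q (q ^ n) f (suc j) k) (≡.trans (q*≈shiftQ (q ^ n * f) (suc j) k) (q^*-< n f j k j<n))

  coeff-q^* : ∀ x n f k → coeff (x ℤ.- + n) f k ≡ coeff x (q ^ n * f) k
  coeff-q^* (+ j) n f k with n ℕ.≤? j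
  ... | yes n≤j = ≡.trans (≡.cong (λ x → coeff x f k) (≡.trans (ℤ.m-n≡m⊖n j n) (ℤ.⊖-≥ n≤j))) (≡.sym (q^*-≤ n f j k n≤j))
  ... | no  n≰j = ≡.trans (≡.cong (λ x → coeff x f k) (≡.trans (ℤ.m-n≡m⊖n j n) (ℤ.⊖-< j<n)))
                          (≡.trans (negative (n ∸ j) (ℕ.m<n⇒0<n∸m j<n)) (≡.sym (q^*-< n f j k j<n)))
    where
    j<n : j < n
    j<n = ℕ.≰⇒> n≰j
    negative : ∀ d → 0 < d → coeff (ℤ.- (+ d)) f k ≡ 0ℚ
    negative (suc d) _ = ≡.refl
  coeff-q^* -[1+ j ] n f k = ≡.cong (λ x → coeff x f k) (ℤ.neg-minus-pos j n)

  lcoef-q^ : ∀ s n f e k → lcoef (laurent (s ℤ.+ + n) f) e k ≡ lcoef (laurent s (q ^ n * f)) e k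
  lcoef-q^ s n f e k = begin
    lcoef (laurent (s ℤ.+ + n) f) e k       ≡⟨ lcoef≡coeff (laurent (s ℤ.+ + n) f) e k ⟩
    coeff (e ℤ.- (s ℤ.+ + n)) f k           ≡⟨ ≡.cong (λ x → coeff x f k) (regroup e s (+ n)) ⟩
    coeff ((e ℤ.- s) ℤ.- + n) f k           ≡⟨ coeff-q^* (e ℤ.- s) n f k ⟩
    coeff (e ℤ.- s) (q ^ n * f) k           ≡⟨ lcoef≡coeff (laurent s (q ^ n * f)) e k ⟨
    lcoef (laurent s (q ^ n * f)) e k       ∎
    where
    regroup : ∀ e s n → e ℤ.- (s ℤ.+ n) ≡ (e ℤ.- s) ℤ.- n
    regroup = solve-∀

  lcoef-lZero : ∀ e k → lcoef lZero e k ≡ 0ℚ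
  lcoef-lZero e k = ≡.trans (lcoef≡coeff lZero e k) (zero-series (e ℤ.- + 0))
    where
    zero-series : ∀ x → coeff x (λ _ _ → 0ℚ) k ≡ 0ℚ
    zero-series (+ j)    = ≡.refl
    zero-series -[1+ j ] = ≡.refl


module Corollary (m : ℕ) (m0 : ℤ) where

  open import Data.Integer.Tactic.RingSolver using (solve-∀)
  open import Defs using (PS; laurent; lcoef; lMul; qPow; Fser; tPow; beta; psMul; psPow; psOne)

  open Bivariate
  open LaurentCoefficients
  open NarayanaEquation using (G; narayana-equation)
  open BetaRecurrence using (β₀≈2; β₁≈s; β-recurrence)
  open ℚAlgebra ℚ[[t]][[q]] ιℚ using (lucas-power)

  W : PS
  W = t ^ m * (G ^ m * G ^ m)

  βG^m : beta m * G ^ m ≈ q ^ m + q ^ m * W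
  βG^m = trans (lucas-power beta narayana-equation β₀≈2 β₁≈s β-recurrence m)
               (+-congˡ {q ^ m} (solve 3 (λ a b c → a :* b :* c := b :* (a :* c)) refl (t ^ m) (q ^ m) (G ^ m * G ^ m)))

  private
    Gᵐ≈ : psMul (psPow G m) psOne ≈ G ^ m
    Gᵐ≈ = trans (psMul≈* (psPow G m) psOne) (trans (*-cong {psPow G m} {G ^ m} {psOne} {1#} (psPow≈^ G m) psOne≈1) (*-identityʳ (G ^ m)))

  offset : ℤ → ℤ
  offset e = e ℤ.- ℤ.- m0

  lcoef-qPow : ∀ e k → lcoef (qPow (+ m ℤ.- m0)) e k ≡ coeff (offset e) (q ^ m) k
  lcoef-qPow e k = begin
    lcoef (laurent (+ m ℤ.- m0) psOne) e k        ≡⟨ lcoef-laurent-cong (shifted (+ m) m0) refl e k ⟩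
    lcoef (laurent (ℤ.- m0 ℤ.+ + m) psOne) e k    ≡⟨ lcoef-q^ (ℤ.- m0) m psOne e k ⟩
    lcoef (laurent (ℤ.- m0) (q ^ m * psOne)) e k  ≡⟨ lcoef-laurent-cong ≡.refl (trans (*-congˡ {q ^ m} psOne≈1) (*-identityʳ (q ^ m))) e k ⟩
    lcoef (laurent (ℤ.- m0) (q ^ m)) e k          ≡⟨ lcoef≡coeff (laurent (ℤ.- m0) (q ^ m)) e k ⟩
    coeff (offset e) (q ^ m) k                    ∎
    where
    open ≡.≡-Reasoning
    shifted : ∀ n m0 → n ℤ.- m0 ≡ ℤ.- m0 ℤ.+ n
    shifted = solve-∀

  lcoef-βF : ∀ e k → lcoef (lMul (laurent (+ 0) (beta m)) (Fser m m0)) e k ≡ coeff (offset e) (q ^ m) k ℚ.+ coeff (offset e) (q ^ m * W) k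
  lcoef-βF e k = begin
    lcoef (lMul (laurent (+ 0) (beta m)) (Fser m m0)) e k
      ≡⟨ lcoef-laurent-cong (shifted m0) (trans (psMul≈* (beta m) (psMul (psPow G m) psOne)) (trans (*-congˡ {beta m} Gᵐ≈) βG^m)) e k ⟩
    lcoef (laurent (ℤ.- m0) (q ^ m + q ^ m * W)) e k
      ≡⟨ lcoef≡coeff (laurent (ℤ.- m0) (q ^ m + q ^ m * W)) e k ⟩
    coeff (offset e) (q ^ m + q ^ m * W) k
      ≡⟨ coeff-+ (q ^ m) (q ^ m * W) (offset e) k ⟩
    coeff (offset e) (q ^ m) k ℚ.+ coeff (offset e) (q ^ m * W) k ∎
    where
    open ≡.≡-Reasoning
    shifted : ∀ m0 → + 0 ℤ.+ (+ 0 ℤ.+ ℤ.- m0) ≡ ℤ.- m0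
    shifted = solve-∀

  lcoef-tFF : ∀ e k → lcoef (lMul (lMul (laurent (+ 0) (tPow m)) (qPow (+ m ℤ.+ m0))) (lMul (Fser m m0) (Fser m m0))) e k
                      ≡ coeff (offset e) (q ^ m * W) k
  lcoef-tFF e k = begin
    lcoef (lMul (lMul (laurent (+ 0) (tPow m)) (qPow (+ m ℤ.+ m0))) (lMul (Fser m m0) (Fser m m0))) e k
      ≡⟨ lcoef-laurent-cong (shifted (+ m) m0) series e k ⟩
    lcoef (laurent (ℤ.- m0 ℤ.+ + m) W) e k
      ≡⟨ lcoef-q^ (ℤ.- m0) m W e k ⟩
    lcoef (laurent (ℤ.- m0) (q ^ m * W)) e k
      ≡⟨ lcoef≡coeff (laurent (ℤ.- m0) (q ^ m * W)) e k ⟩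
    coeff (offset e) (q ^ m * W) k ∎
    where
    open ≡.≡-Reasoning
    shifted : ∀ n m0 → (+ 0 ℤ.+ (n ℤ.+ m0)) ℤ.+ ((+ 0 ℤ.+ ℤ.- m0) ℤ.+ (+ 0 ℤ.+ ℤ.- m0)) ≡ ℤ.- m0 ℤ.+ n
    shifted = solve-∀
    tᵐ≈ : psMul (tPow m) psOne ≈ t ^ m
    tᵐ≈ = trans (psMul≈* (tPow m) psOne) (trans (*-cong {tPow m} {t ^ m} {psOne} {1#} (tPow≈t^ m) psOne≈1) (*-identityʳ (t ^ m)))
    Gᵐ′ Gᵐ′² : PS
    Gᵐ′  = psMul (psPow G m) psOne
    Gᵐ′² = psMul Gᵐ′ Gᵐ′
    series : psMul (psMul (tPow m) psOne) Gᵐ′² ≈ W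
    series = trans (psMul≈* (psMul (tPow m) psOne) Gᵐ′²) (*-cong tᵐ≈ (trans (psMul≈* Gᵐ′ Gᵐ′) (*-cong Gᵐ≈ Gᵐ≈)))

  coefficients-cancel : ∀ e k → ℚ.- lcoef (qPow (+ m ℤ.- m0)) e k ℚ.+ lcoef (lMul (laurent (+ 0) (beta m)) (Fser m m0)) e k
                                 ℚ.+ ℚ.- lcoef (lMul (lMul (laurent (+ 0) (tPow m)) (qPow (+ m ℤ.+ m0))) (lMul (Fser m m0) (Fser m m0))) e k
                                 ≡ 0ℚ
  coefficients-cancel e k = ≡.trans (≡.cong₂ (λ u v → u ℚ.+ v) (≡.cong₂ (λ u v → ℚ.- u ℚ.+ v) (lcoef-qPow e k) (lcoef-βF e k))
                                                               (≡.cong ℚ.-_ (lcoef-tFF e k)))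
                                    (cancel (coeff (offset e) (q ^ m) k) (coeff (offset e) (q ^ m * W) k))
    where
    cancel : ∀ a c → ℚ.- a ℚ.+ (a ℚ.+ c) ℚ.+ ℚ.- c ≡ 0ℚ
    cancel = Tactic.RingSolver.solve-∀ ℚ-ring

open import Defs
open import Data.Nat using (ℕ; _≤_)
open import Data.Integer using (ℤ; +_; _+_; _-_)

-- The identity holds for m = 0 as well.
corollary5p2 : (m : ℕ) → 1 ≤ m → (m0 : ℤ) →
    lZero ≈L lSub (lAdd (lNeg (qPow ((+ m) - m0))) (lMul (laurent (+ 0) (beta m)) (Fser m m0))) (lMul (lMul (laurent (+ 0) (tPow m)) (qPow ((+ m) + m0))) (lMul (Fser m m0) (Fser m m0)))
corollary5p2 m _ m0 e k = ≡.sym (begin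
  lcoef (lSub (lAdd (lNeg P) X) Y) e k                 ≡⟨ lcoef-lAdd (lAdd (lNeg P) X) (lNeg Y) e k ⟩
  lcoef (lAdd (lNeg P) X) e k ℚ.+ lcoef (lNeg Y) e k   ≡⟨ ≡.cong₂ ℚ._+_ (≡.trans (lcoef-lAdd (lNeg P) X e k) (≡.cong (ℚ._+ lcoef X e k) (lcoef-lNeg P e k)))
                                                                        (lcoef-lNeg Y e k) ⟩
  ℚ.- lcoef P e k ℚ.+ lcoef X e k ℚ.+ ℚ.- lcoef Y e k  ≡⟨ Corollary.coefficients-cancel m m0 e k ⟩
  0ℚ                                                   ≡⟨ lcoef-lZero e k ⟨
  lcoef lZero e k                                      ∎)
  where
  open ≡.≡-Reasoning
  open LaurentCoefficients using (lcoef-lAdd; lcoef-lNeg; lcoef-lZero)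
  P X Y : Laurent
  P = qPow ((+ m) - m0)
  X = lMul (laurent (+ 0) (beta m)) (Fser m m0)
  Y = lMul (lMul (laurent (+ 0) (tPow m)) (qPow ((+ m) + m0))) (lMul (Fser m m0) (Fser m m0))
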